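{- Let $G$ be a graph with $n-1$ vertices, where $n \geq 4$, and $s \geq 3$ edges $e_1,\dots,e_s$, with $e_i = u_i v_i$. Let $M = K_1 \vee G$, where $w$ is the added vertex, so $M$ has $n$ vertices and $n+s-1$ edges. Let $m \in \mathbb{N}$ and let $\mathcal{H}=(L,H)$ be an $m$-fold cover of $M$ such that $|E_H(L(u),L(v))| = m$ for every $uv \in E(M)$, $L(u) = \{(u,j): j \in [m]\}$ for each $u \in V(M)$, and $(w,j)(v,j) \in E(H)$ for each $v \in V(G)$ and $j \in [m]$. For $i \in [s]$ let $x_{i}$ be the number of edges of $E_H(L(u_i),L(v_i))$ joining vertices with different second coordinates, and let $x_{\mathcal{H}} = \sum_{i=1}^s x_i$. Let $\mathcal{U} = \{ I \subseteq V(H) : |L(v) \cap I| = 1 \text{ for each } v \in V(M)\}$, and for each edge $e = uv \in E(M)$ let $S_e$ be the set of all $I \in \mathcal{U}$ such that $H[I]$ contains an edge of $E_H(L(u),L(v))$. For $F \subseteq E(M)$ write $S_F = \bigcap_{e \in F} S_e$. Let $t$ be the number of 3-cycles of $M$, and for $i \in \{3,4,5,6\}$ let $P_i$ be the set of all $F \subseteq E(M)$ with $|F| = i$ such that the spanning subgraph of $M$ with edge set $F$ has exactly $n-3$ components. Then: (i) $\sum_{F \subseteq E(M),\, |F|=3} |S_F| \leq t m^{n-2} - x_{\mathcal{H}} m^{n-3} + |P_3| m^{n-3}$; (ii) $\sum_{F \subseteq E(M),\, |F|=4} |S_F| \geq |P_4| m^{n-3} - 2|P_4| x_{\mathcal{H}}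 m^{n-4}$; (iii) $\sum_{F \subseteq E(M),\, |F|=5} |S_F| \leq |P_5| m^{n-3} + \left(\binom{n+s-1}{5} - |P_5|\right) m^{n-4}$; (iv) $\sum_{F \subseteq E(M),\, |F|=6} |S_F| \geq |P_6| m^{n-3} - 2|P_6| x_{\mathcal{H}} m^{n-4}$; (v) for every $k \geq 7$, $\sum_{F \subseteq E(M),\, |F|=k} |S_F| \leq \binom{n+s-1}{k} m^{n-4}$.
   Context: All graphs are finite and simple; $[m]=\{1,\dots,m\}$. $K_1 \vee G$ denotes the join of a single new vertex $w$ with $G$ ($w$ adjacent to all vertices of $G$). A cover of a graph $G$ is a pair $\mathcal{H}=(L,H)$ where $H$ is a graph and $L: V(G) \to \mathcal{P}(V(H))$ satisfies: (1) $\{L(u): u \in V(G)\}$ is a partition of $V(H)$; (2) for every $u$, $H[L(u)]$ is complete; (3) if $E_H(L(u),L(v))$ is nonempty then $u=v$ or $uv \in E(G)$; (4) if $uv \in E(G)$, then $E_H(L(u),L(v))$ is a matching. Here $E_H(S,U)$ is the set of edges of $H$ with one endpoint in $S$ and one in $U$. The cover is $m$-fold if $|L(u)|=m$ for all $u$. -}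

module Defs where

open import Data.Nat using (ℕ; zero; suc; _+_; _*_; _<ᵇ_; _≡ᵇ_)
open import Data.Bool using (Bool; true; false; _∧_; _∨_; not; if_then_else_)
open import Data.Fin using (Fin; zero; suc; toℕ; _≟_)
open import Data.List using (List; []; _∷_; map; _++_; concatMap; filterᵇ; length; allFin)
open import Data.Nat.ListAction using (sum)
open import Data.Bool.ListAction using (any; all)
open import Data.Product using (_×_; _,_)
open import Relation.Nullary using (¬_)
open import Relation.Nullary.Decidable using (isYes)
open import Relation.Binary.PropositionalEquality using (_≡_)

count : {A : Set} → (A → Bool) → List A → ℕ
count p xs = length (filterᵇ p xs)

combs : {A : Set} → ℕ → List A → List (List A)
combs zero    _        = [] ∷ []
combs (suc k) []       = []
combs (suc k) (x ∷ xs) = map (x ∷_) (combs k xs) ++ combs (suc k) xs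

_==_ : {N : ℕ} → Fin N → Fin N → Bool
u == v = isYes (u ≟ v)

allPairs : (N : ℕ) → List (Fin N × Fin N)
allPairs N = concatMap (λ a → map (λ b → (a , b)) (allFin N)) (allFin N)

record SimpleGraph (N : ℕ) : Set where
  field
    adj    : Fin N → Fin N → Bool
    sym    : ∀ u v → adj u v ≡ adj v u
    irrefl : ∀ u → adj u u ≡ false
open SimpleGraph public

edges : {N : ℕ} → SimpleGraph N → List (Fin N × Fin N)
edges {N} G = filterᵇ (λ { (u , v) → (toℕ u <ᵇ toℕ v) ∧ adj G u v }) (allPairs N)

-- The join K₁ ∨ G; the new vertex w is  zero  and v ∈ V(G) becomes  suc v

joinAdj : {N : ℕ} → SimpleGraph N → Fin (suc N) → Fin (suc N) → Bool
joinAdj G zero    zero    = false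
joinAdj G zero    (suc v) = true
joinAdj G (suc u) zero    = true
joinAdj G (suc u) (suc v) = adj G u v

joinSym : {N : ℕ} (G : SimpleGraph N) → ∀ u v → joinAdj G u v ≡ joinAdj G v u
joinSym G zero    zero    = _≡_.refl
joinSym G zero    (suc v) = _≡_.refl
joinSym G (suc u) zero    = _≡_.refl
joinSym G (suc u) (suc v) = sym G u v

joinIrrefl : {N : ℕ} (G : SimpleGraph N) → ∀ u → joinAdj G u u ≡ false
joinIrrefl G zero    = _≡_.refl
joinIrrefl G (suc u) = irrefl G u

K1∨ : {N : ℕ} → SimpleGraph N → SimpleGraph (suc N)
K1∨ G = record { adj = joinAdj G ; sym = joinSym G ; irrefl = joinIrrefl G }

-- m-fold covers (L , H) of a graph M on Fin N with L(u) = {(u , j) : j ∈ [m]}.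
-- V(H) = Fin N × Fin m, so (1) the partition condition and |L(u)| = m hold
-- by construction.

record Cover {N : ℕ} (M : SimpleGraph N) (m : ℕ) : Set where
  field
    hadj     : Fin N × Fin m → Fin N × Fin m → Bool
    hsym     : ∀ x y → hadj x y ≡ hadj y x
    hirrefl  : ∀ x → hadj x x ≡ false
    complete : ∀ u j j′ → ¬ (j ≡ j′) → hadj (u , j) (u , j′) ≡ true
    respects : ∀ u v j j′ → ¬ (u ≡ v) → hadj (u , j) (v , j′) ≡ true → adj M u v ≡ true
    matching : ∀ u v j j₁ j₂ → adj M u v ≡ true →
               hadj (u , j) (v , j₁) ≡ true → hadj (u , j) (v , j₂) ≡ true → j₁ ≡ j₂
open Cover public

consF : {K m : ℕ} → Fin m → (Fin K → Fin m) → Fin (suc K) → Fin m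
consF j f zero    = j
consF j f (suc i) = f i

allFuns : (K m : ℕ) → List (Fin K → Fin m)
allFuns zero    m = (λ ()) ∷ []
allFuns (suc K) m = concatMap (λ j → map (consF j) (allFuns K m)) (allFin m)

module _ {N m : ℕ} {M : SimpleGraph N} (H : Cover M m) where

  crossCount : Fin N → Fin N → ℕ
  crossCount u v = count (λ { (j , j′) → hadj H (u , j) (v , j′) }) (allPairs m)

  crossedCount : Fin N → Fin N → ℕ
  crossedCount u v =
    count (λ { (j , j′) → not (j == j′) ∧ hadj H (u , j) (v , j′) }) (allPairs m)

  -- I ∈ 𝒰 is represented by the function f with L(v) ∩ I = {(v , f v)}.
  -- I ∈ S_e for e = uv  iff  (u , f u)(v , f v) ∈ E(H).
  inS : (Fin N → Fin m) → Fin N × Fin N → Bool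
  inS f (u , v) = hadj H (u , f u) (v , f v)

  sizeS : List (Fin N × Fin N) → ℕ
  sizeS F = count (λ f → all (inS f) F) (allFuns N m)

  sumS : ℕ → ℕ
  sumS k = sum (map sizeS (combs k (edges M)))

isTriangle : {N : ℕ} → SimpleGraph N → List (Fin N) → Bool
isTriangle G (a ∷ b ∷ c ∷ []) = adj G a b ∧ adj G b c ∧ adj G a c
isTriangle G _                = false

triangles : {N : ℕ} → SimpleGraph N → ℕ
triangles {N} G = count (isTriangle G) (combs 3 (allFin N))

reachBy : {N : ℕ} → List (Fin N × Fin N) → ℕ → Fin N → Fin N → Bool
reachBy F zero    u v = u == v
reachBy F (suc k) u v = reachBy F k u v ∨
  any (λ { (a , b) → (reachBy F k u a ∧ (b == v)) ∨ (reachBy F k u b ∧ (a == v)) }) F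

-- connected in the spanning subgraph (Fin N , F)  (walks of ≤ N edges suffice)
connected : {N : ℕ} → List (Fin N × Fin N) → Fin N → Fin N → Bool
connected {N} F u v = reachBy F N u v

-- number of components of the spanning subgraph with edge set F:
-- the number of vertices that are the least vertex of their component
components : {N : ℕ} → List (Fin N × Fin N) → ℕ
components {N} F =
  count (λ v → not (any (λ u → (toℕ u <ᵇ toℕ v) ∧ connected F u v) (allFin N))) (allFin N)

countP : {N : ℕ} → SimpleGraph N → ℕ → ℕ → ℕ
countP M i c = count (λ F → components F ≡ᵇ c) (combs i (edges M))

-- For F ⊆ E(M) with c components, a transversal in S_F is determined by its values at the
-- least vertex of each component, since E_H(L(u), L(v)) is a matching; so |S_F| ≤ m ^ c.
-- Conversely, of the m ^ c transversals constant on components, those outside S_F hit a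
-- missing edge (u , j)(v , j) for some uv ∈ F, and there are at most x m ^ (c − 1) of them.
-- An edge set of size i and rank r satisfies r ≤ i ≤ C(r + 1, 2): hence c ≤ n − 4 for
-- i ≥ 7, c ≤ n − 3 for i ≥ 4, and for i = 3 either c = n − 3 or F is a triangle. A triangle
-- w u_i v_i gives exactly (m − x_i) m ^ (n − 3), which produces the term − x m ^ (n − 3) in (i).

module Submission where

open import Defs hiding (sym)
open import Data.Nat using (ℕ; zero; suc; _+_; _*_; _∸_; _^_; _≤_; _<_; z≤n; s≤s; _<ᵇ_; _≡ᵇ_)
open import Data.Nat.Properties
open import Algebra.Properties.CommutativeSemigroup +-commutativeSemigroup using (interchange)
open import Data.Nat.Combinatorics using (_C_; nC1≡n; nCk+nC[k+1]≡[n+1]C[k+1])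
open import Data.Nat.ListAction using (sum)
open import Data.Bool using (Bool; true; false; _∧_; _∨_; not; if_then_else_; T)
open import Data.Bool.Properties using (∧-identityʳ; ∧-zeroʳ)
open import Data.Bool.ListAction using (any; all)
open import Data.Fin using (Fin; zero; suc; toℕ; fromℕ; fromℕ<)
open import Data.Fin.Properties using (toℕ-injective; toℕ-fromℕ; toℕ-fromℕ<; toℕ≤n) renaming (_≟_ to _≟F_; suc-injective to Fin-suc-injective)
open import Data.List using (List; []; _∷_; map; _++_; concatMap; filterᵇ; length; allFin)
open import Data.List.Properties using (length-++; map-++; map-∘; length-map; map-tabulate; length-tabulate)
open import Data.List.Membership.Propositional using (_∈_)
open import Data.List.Membership.Propositional.Properties
  using (∈-allFin; ∈-map⁺; ∈-map⁻; ∈-++⁺ˡ; ∈-++⁺ʳ; ∈-++⁻; ∈-∃++)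
open import Data.List.Relation.Unary.Any using (here; there)
open import Data.List.Relation.Unary.All using (All; []; _∷_)
import Data.List.Relation.Unary.All as All
open import Data.List.Relation.Unary.AllPairs using (AllPairs; []; _∷_)
import Data.List.Relation.Unary.AllPairs as AllPairs
import Data.List.Relation.Unary.AllPairs.Properties as AllPairs
open import Data.Maybe using (Maybe; just; nothing; fromMaybe)
import Data.Maybe as Maybe
open import Data.Product using (Σ; ∃-syntax; _×_; _,_; proj₁; proj₂; map₁)
open import Data.Sum using (_⊎_; inj₁; inj₂)
open import Data.Empty using (⊥; ⊥-elim)
open import Data.Unit using (tt)
open import Relation.Nullary using (¬_; yes; no)
open import Relation.Binary.PropositionalEquality
open import Function using (_∘_; id)

𝟙 : Bool → ℕ
𝟙 true  = 1
𝟙 false = 0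

true≢false : ∀ {a} → a ≡ true → a ≡ false → ⊥
true≢false refl ()

∨-trueˡ : ∀ {a b} → a ≡ true → (a ∨ b) ≡ true
∨-trueˡ refl = refl

∨-trueʳ : ∀ {a b} → b ≡ true → (a ∨ b) ≡ true
∨-trueʳ {true}  _ = refl
∨-trueʳ {false} e = e

∨-true⁻ : ∀ {a b} → (a ∨ b) ≡ true → a ≡ true ⊎ b ≡ true
∨-true⁻ {true}  _ = inj₁ refl
∨-true⁻ {false} e = inj₂ e

∧-true⁻ : ∀ {a b} → (a ∧ b) ≡ true → a ≡ true × b ≡ true
∧-true⁻ {true} {true} _ = refl , refl

∧-true⁺ : ∀ {a b} → a ≡ true → b ≡ true → (a ∧ b) ≡ true
∧-true⁺ refl refl = refl

not-true⁻ : ∀ {a} → not a ≡ true → a ≡ false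
not-true⁻ {false} _ = refl

not-false⁻ : ∀ {a} → not a ≡ false → a ≡ true
not-false⁻ {true} _ = refl

≡true-ext : ∀ {a b} → (a ≡ true → b ≡ true) → (b ≡ true → a ≡ true) → a ≡ b
≡true-ext {true}  {true}  f g = refl
≡true-ext {true}  {false} f g = sym (f refl)
≡true-ext {false} {true}  f g = g refl
≡true-ext {false} {false} f g = refl

𝟙-mono : ∀ {a b} → (a ≡ true → b ≡ true) → 𝟙 a ≤ 𝟙 b
𝟙-mono {true}  {true}  h = ≤-refl
𝟙-mono {true}  {false} h with () ← h refl
𝟙-mono {false}         h = z≤n

𝟙-∨ : ∀ {a b c} → (a ≡ true → b ≡ true ⊎ c ≡ true) → 𝟙 a ≤ 𝟙 b + 𝟙 c
𝟙-∨ {false}                 h = z≤n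
𝟙-∨ {true} {true}           h = s≤s z≤n
𝟙-∨ {true} {false} {true}   h = s≤s z≤n
𝟙-∨ {true} {false} {false}  h with h refl
... | inj₁ ()
... | inj₂ ()

𝟙-∧ : ∀ a b → 𝟙 (a ∧ b) ≡ 𝟙 a * 𝟙 b
𝟙-∧ true  b = sym (+-identityʳ (𝟙 b))
𝟙-∧ false b = refl

<ᵇ-true⇒< : ∀ {a b} → (a <ᵇ b) ≡ true → a < b
<ᵇ-true⇒< {a} {b} e = <ᵇ⇒< a b (subst T (sym e) tt)

<⇒<ᵇ-true : ∀ {a b} → a < b → (a <ᵇ b) ≡ true
<⇒<ᵇ-true {a} {b} h with a <ᵇ b | <⇒<ᵇ h
... | true | _ = refl

≡ᵇ-true⇒≡ : ∀ {a b} → (a ≡ᵇ b) ≡ true → a ≡ b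
≡ᵇ-true⇒≡ {a} {b} e = ≡ᵇ⇒≡ a b (subst T (sym e) tt)

≡ᵇ-false⇒≢ : ∀ {a b} → (a ≡ᵇ b) ≡ false → ¬ (a ≡ b)
≡ᵇ-false⇒≢ {a} e refl with a ≡ᵇ a | ≡⇒≡ᵇ a a refl
≡ᵇ-false⇒≢ () refl | true | _

==-refl : {N : ℕ} (v : Fin N) → (v == v) ≡ true
==-refl v with v ≟F v
... | yes _  = refl
... | no v≢v = ⊥-elim (v≢v refl)

==⇒≡ : {N : ℕ} {u v : Fin N} → (u == v) ≡ true → u ≡ v
==⇒≡ {u = u} {v} h with u ≟F v
... | yes p = p

≢⇒==false : {N : ℕ} {u v : Fin N} → ¬ (u ≡ v) → (u == v) ≡ false
≢⇒==false {u = u} {v} h with u ≟F v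
... | yes p = ⊥-elim (h p)
... | no _  = refl

suc==suc : {N : ℕ} (u v : Fin N) → (suc u == suc v) ≡ (u == v)
suc==suc u v with u ≟F v
... | yes _ = refl
... | no _  = refl

module _ {A : Set} where

  count-∷ : (p : A → Bool) (x : A) (xs : List A) → count p (x ∷ xs) ≡ 𝟙 (p x) + count p xs
  count-∷ p x xs with p x
  ... | true  = refl
  ... | false = refl

  count-++ : (p : A → Bool) (xs ys : List A) → count p (xs ++ ys) ≡ count p xs + count p ys
  count-++ p []       ys = refl
  count-++ p (x ∷ xs) ys = begin
    count p (x ∷ xs ++ ys)              ≡⟨ count-∷ p x (xs ++ ys) ⟩
    𝟙 (p x) + count p (xs ++ ys)        ≡⟨ cong (𝟙 (p x) +_) (count-++ p xs ys) ⟩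
    𝟙 (p x) + (count p xs + count p ys) ≡⟨ +-assoc (𝟙 (p x)) _ _ ⟨
    𝟙 (p x) + count p xs + count p ys   ≡⟨ cong (_+ count p ys) (count-∷ p x xs) ⟨
    count p (x ∷ xs) + count p ys       ∎
    where open ≡-Reasoning

  count-cong : {p q : A → Bool} (xs : List A) → (∀ x → x ∈ xs → p x ≡ q x) → count p xs ≡ count q xs
  count-cong {p} {q} []       h = refl
  count-cong {p} {q} (x ∷ xs) h = trans (count-∷ p x xs)
    (trans (cong₂ _+_ (cong 𝟙 (h x (here refl))) (count-cong xs (λ y y∈ → h y (there y∈))))
           (sym (count-∷ q x xs)))

  count-mono : {p q : A → Bool} (xs : List A) → (∀ x → x ∈ xs → p x ≡ true → q x ≡ true) →
    count p xs ≤ count q xs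
  count-mono         []       h = z≤n
  count-mono {p} {q} (x ∷ xs) h = subst₂ _≤_ (sym (count-∷ p x xs)) (sym (count-∷ q x xs))
    (+-mono-≤ (𝟙-mono (h x (here refl))) (count-mono xs (λ y y∈ → h y (there y∈))))

  count-∨ : {p q r : A → Bool} (xs : List A) →
    (∀ x → x ∈ xs → p x ≡ true → q x ≡ true ⊎ r x ≡ true) → count p xs ≤ count q xs + count r xs
  count-∨             []       h = z≤n
  count-∨ {p} {q} {r} (x ∷ xs) h =
    subst₂ _≤_ (sym (count-∷ p x xs)) (sym (cong₂ _+_ (count-∷ q x xs) (count-∷ r x xs)))
      (≤-trans (+-mono-≤ (𝟙-∨ (h x (here refl))) (count-∨ xs (λ y y∈ → h y (there y∈))))
               (≤-reflexive (interchange (𝟙 (q x)) (𝟙 (r x)) _ _)))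

  count-≤-length : (p : A → Bool) (xs : List A) → count p xs ≤ length xs
  count-≤-length p []       = z≤n
  count-≤-length p (x ∷ xs) with p x
  ... | true  = s≤s (count-≤-length p xs)
  ... | false = m≤n⇒m≤1+n (count-≤-length p xs)

  count-const-true : (xs : List A) → count (λ _ → true) xs ≡ length xs
  count-const-true []       = refl
  count-const-true (x ∷ xs) = cong suc (count-const-true xs)

  count-none : {p : A → Bool} (xs : List A) → (∀ x → x ∈ xs → p x ≡ false) → count p xs ≡ 0
  count-none     []       h = refl
  count-none {p} (x ∷ xs) h = trans (count-∷ p x xs)
    (cong₂ _+_ (cong 𝟙 (h x (here refl))) (count-none xs (λ y y∈ → h y (there y∈))))

  count+count-not : (p : A → Bool) (xs : List A) → count p xs + count (not ∘ p) xs ≡ length xs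
  count+count-not p []       = refl
  count+count-not p (x ∷ xs) with p x
  ... | true  = cong suc (count+count-not p xs)
  ... | false = trans (+-suc (count p xs) _) (cong suc (count+count-not p xs))

  count-pos⇒∃ : (p : A → Bool) (xs : List A) → 0 < count p xs → ∃[ x ] (x ∈ xs × p x ≡ true)
  count-pos⇒∃ p (x ∷ xs) h with p x in px
  ... | true  = x , here refl , px
  ... | false with count-pos⇒∃ p xs h
  ...   | y , y∈ , py = y , there y∈ , py

  ∃⇒count-pos : (p : A → Bool) {xs : List A} {x : A} → x ∈ xs → p x ≡ true → 0 < count p xs
  ∃⇒count-pos p {y ∷ xs} (here refl) px rewrite count-∷ p y xs | px = s≤s z≤n
  ∃⇒count-pos p {y ∷ xs} (there x∈)  px rewrite count-∷ p y xs =
    ≤-trans (∃⇒count-pos p x∈ px) (m≤n+m _ _)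

  count-strict-mono : {p q : A → Bool} (xs : List A) → (∀ x → x ∈ xs → p x ≡ true → q x ≡ true) →
    ∀ {x₀} → x₀ ∈ xs → q x₀ ≡ true → p x₀ ≡ false → count p xs < count q xs
  count-strict-mono {p} {q} (y ∷ xs) h (here refl) qy py
    rewrite count-∷ p y xs | count-∷ q y xs | qy | py = s≤s (count-mono xs (λ x x∈ → h x (there x∈)))
  count-strict-mono {p} {q} (y ∷ xs) h (there x₀∈) qx₀ px₀
    rewrite count-∷ p y xs | count-∷ q y xs =
    subst (_≤ 𝟙 (q y) + count q xs) (+-suc (𝟙 (p y)) (count p xs))
      (+-mono-≤ (𝟙-mono (h y (here refl))) (count-strict-mono xs (λ x x∈ → h x (there x∈)) x₀∈ qx₀ px₀))

module _ {A : Set} where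

  sum-map-cong : {f g : A → ℕ} (xs : List A) → (∀ x → x ∈ xs → f x ≡ g x) →
    sum (map f xs) ≡ sum (map g xs)
  sum-map-cong []       h = refl
  sum-map-cong (x ∷ xs) h = cong₂ _+_ (h x (here refl)) (sum-map-cong xs (λ y y∈ → h y (there y∈)))

  sum-map-mono : {f g : A → ℕ} (xs : List A) → (∀ x → x ∈ xs → f x ≤ g x) →
    sum (map f xs) ≤ sum (map g xs)
  sum-map-mono []       h = z≤n
  sum-map-mono (x ∷ xs) h = +-mono-≤ (h x (here refl)) (sum-map-mono xs (λ y y∈ → h y (there y∈)))

  sum-map-+ : (f g : A → ℕ) (xs : List A) →
    sum (map (λ x → f x + g x) xs) ≡ sum (map f xs) + sum (map g xs)
  sum-map-+ f g []       = refl
  sum-map-+ f g (x ∷ xs) = trans (cong (f x + g x +_) (sum-map-+ f g xs)) (interchange (f x) (g x) _ _)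

  sum-map-*ˡ : (c : ℕ) (f : A → ℕ) (xs : List A) → sum (map (λ x → c * f x) xs) ≡ c * sum (map f xs)
  sum-map-*ˡ c f []       = sym (*-zeroʳ c)
  sum-map-*ˡ c f (x ∷ xs) = trans (cong (c * f x +_) (sum-map-*ˡ c f xs)) (sym (*-distribˡ-+ c (f x) _))

  sum-map-*ʳ : (c : ℕ) (f : A → ℕ) (xs : List A) → sum (map (λ x → f x * c) xs) ≡ sum (map f xs) * c
  sum-map-*ʳ c f xs = trans (sum-map-cong xs (λ x _ → *-comm (f x) c)) (trans (sum-map-*ˡ c f xs) (*-comm c _))

  sum-map-const : (c : ℕ) (xs : List A) → sum (map (λ _ → c) xs) ≡ length xs * c
  sum-map-const c []       = refl
  sum-map-const c (x ∷ xs) = cong (c +_) (sum-map-const c xs)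

  sum-map-𝟙 : (p : A → Bool) (xs : List A) → sum (map (λ x → 𝟙 (p x)) xs) ≡ count p xs
  sum-map-𝟙 p []       = refl
  sum-map-𝟙 p (x ∷ xs) = trans (cong (𝟙 (p x) +_) (sum-map-𝟙 p xs)) (sym (count-∷ p x xs))

  sum-map-𝟙* : (p : A → Bool) (c : ℕ) (xs : List A) → sum (map (λ x → 𝟙 (p x) * c) xs) ≡ count p xs * c
  sum-map-𝟙* p c xs = trans (sum-map-*ʳ c (λ x → 𝟙 (p x)) xs) (cong (_* c) (sum-map-𝟙 p xs))

  sum-map-++ : (f : A → ℕ) (xs ys : List A) → sum (map f (xs ++ ys)) ≡ sum (map f xs) + sum (map f ys)
  sum-map-++ f []       ys = refl
  sum-map-++ f (x ∷ xs) ys = trans (cong (f x +_) (sum-map-++ f xs ys)) (sym (+-assoc (f x) _ _))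

  sum-map-filterᵇ : (p : A → Bool) (f : A → ℕ) (xs : List A) →
    sum (map f (filterᵇ p xs)) ≡ sum (map (λ x → 𝟙 (p x) * f x) xs)
  sum-map-filterᵇ p f []       = refl
  sum-map-filterᵇ p f (x ∷ xs) with p x
  ... | true  = cong₂ _+_ (sym (+-identityʳ (f x))) (sum-map-filterᵇ p f xs)
  ... | false = sum-map-filterᵇ p f xs

module _ {A B : Set} where

  count-map : (p : B → Bool) (f : A → B) (xs : List A) → count p (map f xs) ≡ count (p ∘ f) xs
  count-map p f []       = refl
  count-map p f (x ∷ xs) = trans (count-∷ p (f x) (map f xs))
    (trans (cong (𝟙 (p (f x)) +_) (count-map p f xs)) (sym (count-∷ (p ∘ f) x xs)))

  count-concatMap : (p : B → Bool) (f : A → List B) (xs : List A) →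
    count p (concatMap f xs) ≡ sum (map (λ x → count p (f x)) xs)
  count-concatMap p f []       = refl
  count-concatMap p f (x ∷ xs) =
    trans (count-++ p (f x) (concatMap f xs)) (cong (count p (f x) +_) (count-concatMap p f xs))

  sum-map-map : (f : B → ℕ) (g : A → B) (xs : List A) → sum (map f (map g xs)) ≡ sum (map (f ∘ g) xs)
  sum-map-map f g xs = cong sum (sym (map-∘ xs))

  sum-map-concatMap : (f : B → ℕ) (g : A → List B) (xs : List A) →
    sum (map f (concatMap g xs)) ≡ sum (map (λ x → sum (map f (g x))) xs)
  sum-map-concatMap f g []       = refl
  sum-map-concatMap f g (x ∷ xs) =
    trans (sum-map-++ f (g x) (concatMap g xs)) (cong (sum (map f (g x)) +_) (sum-map-concatMap f g xs))

  sum-swap : (f : A → B → ℕ) (xs : List A) (ys : List B) →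
    sum (map (λ x → sum (map (f x) ys)) xs) ≡ sum (map (λ y → sum (map (λ x → f x y) xs)) ys)
  sum-swap f []       ys = sym (trans (sum-map-const 0 ys) (*-zeroʳ (length ys)))
  sum-swap f (x ∷ xs) ys = trans (cong (sum (map (f x) ys) +_) (sum-swap f xs ys))
    (sym (sum-map-+ (f x) (λ y → sum (map (λ x′ → f x′ y) xs)) ys))

  sum-map-≤-injection : (xs : List A) (ys : List B) (g : A → B) (a : A → ℕ) (b : B → ℕ) →
    AllPairs (λ x y → ¬ (x ≡ y)) xs → (∀ x → x ∈ xs → g x ∈ ys) →
    (∀ x y → x ∈ xs → y ∈ xs → g x ≡ g y → x ≡ y) → (∀ x → x ∈ xs → a x ≤ b (g x)) →
    sum (map a xs) ≤ sum (map b ys)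
  sum-map-≤-injection []       ys g a b _          g∈ inj a≤b = z≤n
  sum-map-≤-injection (x ∷ xs) ys g a b (x∉ ∷ xs!) g∈ inj a≤b with ∈-∃++ (g∈ x (here refl))
  ... | us , vs , refl = begin
    a x + sum (map a xs)                       ≤⟨ +-mono-≤ (a≤b x (here refl)) (sum-map-≤-injection xs (us ++ vs) g a b xs!
                                                    g∈′ (λ y z y∈ z∈ → inj y z (there y∈) (there z∈))
                                                    (λ y y∈ → a≤b y (there y∈))) ⟩
    b (g x) + sum (map b (us ++ vs))           ≡⟨ cong (b (g x) +_) (sum-map-++ b us vs) ⟩
    b (g x) + (sum (map b us) + sum (map b vs)) ≡⟨ +-assoc (b (g x)) _ _ ⟨
    b (g x) + sum (map b us) + sum (map b vs)  ≡⟨ cong (_+ sum (map b vs)) (+-comm (b (g x)) _) ⟩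
    sum (map b us) + b (g x) + sum (map b vs)  ≡⟨ +-assoc (sum (map b us)) _ _ ⟩
    sum (map b us) + sum (map b (g x ∷ vs))    ≡⟨ sum-map-++ b us (g x ∷ vs) ⟨
    sum (map b (us ++ g x ∷ vs))               ∎
    where
    open ≤-Reasoning
    g∈′ : ∀ y → y ∈ xs → g y ∈ us ++ vs
    g∈′ y y∈ with ∈-++⁻ us (g∈ y (there y∈))
    ... | inj₁ gy∈       = ∈-++⁺ˡ gy∈
    ... | inj₂ (here gy≡) = ⊥-elim (All.lookup x∉ y∈ (inj x y (here refl) (there y∈) (sym gy≡)))
    ... | inj₂ (there gy∈) = ∈-++⁺ʳ us gy∈

  length-≤-injection : (xs : List A) (ys : List B) (g : A → B) →
    AllPairs (λ x y → ¬ (x ≡ y)) xs → (∀ x → x ∈ xs → g x ∈ ys) →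
    (∀ x y → x ∈ xs → y ∈ xs → g x ≡ g y → x ≡ y) → length xs ≤ length ys
  length-≤-injection xs ys g xs! g∈ inj =
    subst₂ _≤_ (trans (sum-map-const 1 xs) (*-identityʳ _)) (trans (sum-map-const 1 ys) (*-identityʳ _))
      (sum-map-≤-injection xs ys g (λ _ → 1) (λ _ → 1) xs! g∈ inj (λ _ _ → ≤-refl))

allFin-suc : (n : ℕ) → allFin (suc n) ≡ zero ∷ map suc (allFin n)
allFin-suc n = cong (zero ∷_) (sym (map-tabulate id suc))

length-allFin : (n : ℕ) → length (allFin n) ≡ n
length-allFin n = length-tabulate id

sum-allFin-suc : (n : ℕ) (f : Fin (suc n) → ℕ) →
  sum (map f (allFin (suc n))) ≡ f zero + sum (map (f ∘ suc) (allFin n))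
sum-allFin-suc n f = trans (cong (λ l → sum (map f l)) (allFin-suc n)) (cong (f zero +_) (sum-map-map f suc (allFin n)))

count-allFin-suc : (n : ℕ) (p : Fin (suc n) → Bool) →
  count p (allFin (suc n)) ≡ 𝟙 (p zero) + count (p ∘ suc) (allFin n)
count-allFin-suc n p = trans (cong (count p) (allFin-suc n))
  (trans (count-∷ p zero _) (cong (𝟙 (p zero) +_) (count-map p suc (allFin n))))

count-==-allFin : (m : ℕ) (j : Fin m) → count (_== j) (allFin m) ≡ 1
count-==-allFin (suc m) zero = trans (count-allFin-suc m (_== zero))
  (cong suc (count-none (allFin m) (λ y _ → ≢⇒==false {u = suc y} {v = zero} λ ())))
count-==-allFin (suc m) (suc j) = trans (count-allFin-suc m (_== suc j))
  (trans (cong₂ _+_ (cong 𝟙 (≢⇒==false {u = zero} {v = suc j} λ ())) (count-cong (allFin m) (λ y _ → suc==suc y j)))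
         (count-==-allFin m j))

count-allFin-≤1 : (m : ℕ) (p : Fin m → Bool) → (∀ j j′ → p j ≡ true → p j′ ≡ true → j ≡ j′) →
  count p (allFin m) ≤ 1
count-allFin-≤1 zero    p h = z≤n
count-allFin-≤1 (suc m) p h rewrite count-allFin-suc m p with p zero in p0
... | true  = ≤-reflexive (cong suc (count-none (allFin m) (λ j _ → psuc j)))
  where
  psuc : ∀ j → p (suc j) ≡ false
  psuc j with p (suc j) in pj
  ... | false = refl
  ... | true with () ← h zero (suc j) p0 pj
... | false = count-allFin-≤1 m (p ∘ suc) (λ j j′ pj pj′ → Fin-suc-injective (h (suc j) (suc j′) pj pj′))

module _ {A : Set} (p : A → Bool) where

  any-true⁺ : {xs : List A} {x : A} → x ∈ xs → p x ≡ true → any p xs ≡ true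
  any-true⁺ {y ∷ xs} (here refl) px rewrite px = refl
  any-true⁺ {y ∷ xs} (there x∈)  px = ∨-trueʳ {p y} (any-true⁺ x∈ px)

  any-true⁻ : (xs : List A) → any p xs ≡ true → ∃[ x ] (x ∈ xs × p x ≡ true)
  any-true⁻ (y ∷ xs) e with ∨-true⁻ {p y} e
  ... | inj₁ py = y , here refl , py
  ... | inj₂ e′ with any-true⁻ xs e′
  ...   | x , x∈ , px = x , there x∈ , px

  any-false⁺ : (xs : List A) → (∀ x → p x ≡ false) → any p xs ≡ false
  any-false⁺ []       h = refl
  any-false⁺ (x ∷ xs) h rewrite h x = any-false⁺ xs h

  all-true⁻ : (xs : List A) → all p xs ≡ true → ∀ {x} → x ∈ xs → p x ≡ true
  all-true⁻ (y ∷ xs) e (here refl) = proj₁ (∧-true⁻ e)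
  all-true⁻ (y ∷ xs) e (there x∈)  = all-true⁻ xs (proj₂ (∧-true⁻ {p y} e)) x∈

  all-true⁺ : (xs : List A) → (∀ x → x ∈ xs → p x ≡ true) → all p xs ≡ true
  all-true⁺ []       h = refl
  all-true⁺ (y ∷ xs) h rewrite h y (here refl) = all-true⁺ xs (λ x x∈ → h x (there x∈))

  all-false⁻ : (xs : List A) → all p xs ≡ false → ∃[ x ] (x ∈ xs × p x ≡ false)
  all-false⁻ (y ∷ xs) e with p y in py
  ... | false = y , here refl , py
  ... | true with all-false⁻ xs e
  ...   | x , x∈ , px = x , there x∈ , px

  ∈-filterᵇ⁻ : {xs : List A} {x : A} → x ∈ filterᵇ p xs → x ∈ xs × p x ≡ true
  ∈-filterᵇ⁻ {y ∷ xs} x∈ with p y in py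
  ∈-filterᵇ⁻ {y ∷ xs} (here refl) | true = here refl , py
  ∈-filterᵇ⁻ {y ∷ xs} (there x∈)  | true = map₁ there (∈-filterᵇ⁻ x∈)
  ∈-filterᵇ⁻ {y ∷ xs} x∈          | false = map₁ there (∈-filterᵇ⁻ x∈)

  ∈-filterᵇ⁺ : {xs : List A} {x : A} → x ∈ xs → p x ≡ true → x ∈ filterᵇ p xs
  ∈-filterᵇ⁺ {y ∷ xs} (here refl) px rewrite px = here refl
  ∈-filterᵇ⁺ {y ∷ xs} (there x∈)  px with p y
  ... | true  = there (∈-filterᵇ⁺ x∈ px)
  ... | false = ∈-filterᵇ⁺ x∈ px

∏ : {K : ℕ} → (Fin K → ℕ) → ℕ
∏ {zero}  w = 1
∏ {suc K} w = w zero * ∏ (w ∘ suc)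

∏-cong : {K : ℕ} {w w′ : Fin K → ℕ} → (∀ v → w v ≡ w′ v) → ∏ w ≡ ∏ w′
∏-cong {zero}  h = refl
∏-cong {suc K} h = cong₂ _*_ (h zero) (∏-cong (h ∘ suc))

∏-if : {K : ℕ} (m : ℕ) (R : Fin K → Bool) → ∏ (λ v → if R v then m else 1) ≡ m ^ count R (allFin K)
∏-if {zero}  m R = refl
∏-if {suc K} m R rewrite count-allFin-suc K R with R zero
... | true  = cong (m *_) (∏-if m (R ∘ suc))
... | false = trans (+-identityʳ _) (∏-if m (R ∘ suc))

∏-if-except : {K : ℕ} (m a : ℕ) (R : Fin K → Bool) (ρ : Fin K) → R ρ ≡ true →
  ∏ (λ v → if v == ρ then a else (if R v then m else 1)) ≡ a * m ^ (count R (allFin K) ∸ 1)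
∏-if-except {suc K} m a R zero Rρ rewrite count-allFin-suc K R | Rρ =
  cong (a *_) (trans (∏-cong (λ v → cong (λ b → if b then a else (if R (suc v) then m else 1)) (≢⇒==false {u = suc v} {v = zero} λ ())))
                     (∏-if m (R ∘ suc)))
∏-if-except {suc K} m a R (suc ρ) Rρ rewrite count-allFin-suc K R =
  trans (cong₂ _*_ (cong (λ b → if b then a else (if R zero then m else 1)) (≢⇒==false {u = zero} {v = suc ρ} λ ()))
                   (trans (∏-cong (λ v → cong (λ b → if b then a else (if R (suc v) then m else 1)) (suc==suc v ρ)))
                          (∏-if-except m a (R ∘ suc) ρ Rρ)))
        (absorb (R zero))
  where
  pos : 0 < count (R ∘ suc) (allFin K)
  pos = ∃⇒count-pos (R ∘ suc) (∈-allFin ρ) Rρ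
  absorb : ∀ b → (if b then m else 1) * (a * m ^ (count (R ∘ suc) (allFin K) ∸ 1))
                 ≡ a * m ^ (𝟙 b + count (R ∘ suc) (allFin K) ∸ 1)
  absorb false = +-identityʳ _
  absorb true with count (R ∘ suc) (allFin K) | pos
  ... | suc c | _ = trans (sym (*-assoc m a _)) (trans (cong (_* m ^ c) (*-comm m a)) (*-assoc a m _))

count-allFuns-suc : (K m : ℕ) (P : (Fin (suc K) → Fin m) → Bool) →
  count P (allFuns (suc K) m) ≡ sum (map (λ j → count (P ∘ consF j) (allFuns K m)) (allFin m))
count-allFuns-suc K m P = trans (count-concatMap P _ (allFin m))
  (sum-map-cong (allFin m) (λ j _ → count-map P (consF j) (allFuns K m)))

≤1⇒≤𝟙-pos : ∀ {c} → c ≤ 1 → c ≤ 𝟙 (0 <ᵇ c)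
≤1⇒≤𝟙-pos {zero}          _ = z≤n
≤1⇒≤𝟙-pos {suc zero}      _ = ≤-refl
≤1⇒≤𝟙-pos {suc (suc c)} (s≤s ())

module _ (m : ℕ) {K : ℕ} where

  Restricted : ((Fin K → Fin m) → Bool) → (Fin K → Bool) → (Fin K → Fin m → Bool) → Set
  Restricted P R A = ∀ f → P f ≡ true → ∀ v → R v ≡ true → A v (f v) ≡ true

  Determined : ((Fin K → Fin m) → Bool) → (Fin K → Bool) → Set
  Determined P R = ∀ f g → P f ≡ true → P g ≡ true → (∀ v → R v ≡ true → f v ≡ g v) → ∀ v → f v ≡ g v

  choices : (Fin K → Bool) → (Fin K → Fin m → Bool) → Fin K → ℕ
  choices R A v = if R v then count (A v) (allFin m) else 1

module _ {m : ℕ} where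

  count-determined-≤ : (K : ℕ) (P : (Fin K → Fin m) → Bool) (R : Fin K → Bool) (A : Fin K → Fin m → Bool) →
    Restricted m P R A → Determined m P R → count P (allFuns K m) ≤ ∏ (choices m R A)

  restricted-head-≤ : (K : ℕ) (P : (Fin (suc K) → Fin m) → Bool) (R : Fin (suc K) → Bool) (A : Fin (suc K) → Fin m → Bool) →
    Restricted m P R A → Determined m P R → R zero ≡ true →
    count P (allFuns (suc K) m) ≤ count (A zero) (allFin m) * ∏ (choices m (R ∘ suc) (A ∘ suc))

  determined-head-≤ : (K : ℕ) (P : (Fin (suc K) → Fin m) → Bool) (R : Fin (suc K) → Bool) (A : Fin (suc K) → Fin m → Bool) →
    Restricted m P R A → Determined m P R → R zero ≡ false →
    count P (allFuns (suc K) m) ≤ 1 * ∏ (choices m (R ∘ suc) (A ∘ suc))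

  count-determined-≤ zero    P R A inA det = count-≤-length P (allFuns zero m)
  count-determined-≤ (suc K) P R A inA det with R zero in R0
  ... | true  = restricted-head-≤ K P R A inA det R0
  ... | false = determined-head-≤ K P R A inA det R0

  restricted-head-≤ K P R A inA det R0 = begin
    count P (allFuns (suc K) m)                                     ≡⟨ count-allFuns-suc K m P ⟩
    sum (map (λ j → count (P ∘ consF j) (allFuns K m)) (allFin m))  ≤⟨ sum-map-mono (allFin m) (λ j _ → fibre j) ⟩
    sum (map (λ j → 𝟙 (A zero j) * ∏′) (allFin m))                 ≡⟨ sum-map-𝟙* (A zero) ∏′ (allFin m) ⟩
    count (A zero) (allFin m) * ∏′                                  ∎
    where
    open ≤-Reasoning
    ∏′ = ∏ (choices m (R ∘ suc) (A ∘ suc))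
    fibre : ∀ j → count (P ∘ consF j) (allFuns K m) ≤ 𝟙 (A zero j) * ∏′
    fibre j with A zero j in A0j
    ... | true = ≤-trans
      (count-determined-≤ K (P ∘ consF j) (R ∘ suc) (A ∘ suc)
        (λ g Pg v Rv → inA (consF j g) Pg (suc v) Rv)
        (λ g g′ Pg Pg′ g≡ v → det (consF j g) (consF j g′) Pg Pg′ (λ { zero _ → refl ; (suc w) Rw → g≡ w Rw }) (suc v)))
      (≤-reflexive (sym (+-identityʳ ∏′)))
    ... | false = ≤-reflexive (count-none (allFuns K m) (λ g _ → ¬P g))
      where
      ¬P : ∀ g → P (consF j g) ≡ false
      ¬P g with P (consF j g) in Pg
      ... | false = refl
      ... | true with () ← trans (sym (inA (consF j g) Pg zero R0)) A0j

  -- Each g : Fin K → Fin m extends in at most one way, so count the g that extend at all.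
  determined-head-≤ K P R A inA det R0 = begin
    count P (allFuns (suc K) m)                                             ≡⟨ count-allFuns-suc K m P ⟩
    sum (map (λ j → count (P ∘ consF j) (allFuns K m)) (allFin m))          ≡⟨ sum-map-cong (allFin m) (λ j _ → sym (sum-map-𝟙 (P ∘ consF j) (allFuns K m))) ⟩
    sum (map (λ j → sum (map (λ g → 𝟙 (P (consF j g))) (allFuns K m))) (allFin m))
                                                                            ≡⟨ sum-swap (λ j g → 𝟙 (P (consF j g))) (allFin m) (allFuns K m) ⟩
    sum (map (λ g → sum (map (λ j → 𝟙 (P (consF j g))) (allFin m))) (allFuns K m))
                                                                            ≡⟨ sum-map-cong (allFuns K m) (λ g _ → sum-map-𝟙 (λ j → P (consF j g)) (allFin m)) ⟩
    sum (map (λ g → count (λ j → P (consF j g)) (allFin m)) (allFuns K m))  ≤⟨ sum-map-mono (allFuns K m) (λ g _ → ≤1⇒≤𝟙-pos (unique g)) ⟩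
    sum (map (λ g → 𝟙 (Q g)) (allFuns K m))                                 ≡⟨ sum-map-𝟙 Q (allFuns K m) ⟩
    count Q (allFuns K m)                                                   ≤⟨ count-determined-≤ K Q (R ∘ suc) (A ∘ suc) inA′ det′ ⟩
    ∏′                                                                      ≡⟨ +-identityʳ ∏′ ⟨
    1 * ∏′                                                                  ∎
    where
    open ≤-Reasoning
    ∏′ = ∏ (choices m (R ∘ suc) (A ∘ suc))
    Q : (Fin K → Fin m) → Bool
    Q g = 0 <ᵇ count (λ j → P (consF j g)) (allFin m)
    ¬R0 : R zero ≢ true
    ¬R0 R0′ with () ← trans (sym R0′) R0
    unique : ∀ g → count (λ j → P (consF j g)) (allFin m) ≤ 1
    unique g = count-allFin-≤1 m _ (λ j j′ Pj Pj′ →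
      det (consF j g) (consF j′ g) Pj Pj′ (λ { zero R0′ → ⊥-elim (¬R0 R0′) ; (suc w) _ → refl }) zero)
    extension : ∀ g → Q g ≡ true → ∃[ j ] (P (consF j g) ≡ true)
    extension g Qg with count-pos⇒∃ (λ j → P (consF j g)) (allFin m) (<ᵇ-true⇒< Qg)
    ... | j , _ , Pjg = j , Pjg
    inA′ : Restricted m Q (R ∘ suc) (A ∘ suc)
    inA′ g Qg v Rv with extension g Qg
    ... | j , Pjg = inA (consF j g) Pjg (suc v) Rv
    det′ : Determined m Q (R ∘ suc)
    det′ g g′ Qg Qg′ g≡ v with extension g Qg | extension g′ Qg′
    ... | j , Pjg | j′ , Pj′g′ =
      det (consF j g) (consF j′ g′) Pjg Pj′g′ (λ { zero R0′ → ⊥-elim (¬R0 R0′) ; (suc w) Rw → g≡ w Rw }) (suc v)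

data Constraint (K m : ℕ) : Set where
  within : (Fin m → Bool) → Constraint K m
  copy   : Fin K → Constraint K m

module _ {K m : ℕ} where

  satisfies : Constraint K m → (Fin K → Fin m) → Fin m → Bool
  satisfies (within A) f y = A y
  satisfies (copy u)   f y = y == f u

  solves : (Fin K → Constraint K m) → (Fin K → Fin m) → Bool
  solves D f = all (λ v → satisfies (D v) f (f v)) (allFin K)

  freedom : Constraint K m → ℕ
  freedom (within A) = count A (allFin m)
  freedom (copy _)   = 1

  Triangular : (Fin K → Constraint K m) → Set
  Triangular D = ∀ v u → D v ≡ copy u → toℕ u < toℕ v

  solves⇒satisfies : (D : Fin K → Constraint K m) (f : Fin K → Fin m) → solves D f ≡ true →
    ∀ v → satisfies (D v) f (f v) ≡ true
  solves⇒satisfies D f e v = all-true⁻ _ (allFin K) e (∈-allFin v)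

  satisfies⇒solves : (D : Fin K → Constraint K m) (f : Fin K → Fin m) →
    (∀ v → satisfies (D v) f (f v) ≡ true) → solves D f ≡ true
  satisfies⇒solves D f h = all-true⁺ _ (allFin K) (λ v _ → h v)

fix₀ : {K m : ℕ} → Fin m → Constraint (suc K) m → Constraint K m
fix₀ j (within A)     = within A
fix₀ j (copy zero)    = within (_== j)
fix₀ j (copy (suc u)) = copy u

module _ {K m : ℕ} (j : Fin m) where

  satisfies-fix₀ : (g : Fin K → Fin m) (d : Constraint (suc K) m) (y : Fin m) →
    satisfies d (consF j g) y ≡ satisfies (fix₀ j d) g y
  satisfies-fix₀ g (within A)     y = refl
  satisfies-fix₀ g (copy zero)    y = refl
  satisfies-fix₀ g (copy (suc u)) y = refl

  freedom-fix₀ : (d : Constraint (suc K) m) → freedom (fix₀ j d) ≡ freedom d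
  freedom-fix₀ (within A)     = refl
  freedom-fix₀ (copy zero)    = count-==-allFin m j
  freedom-fix₀ (copy (suc u)) = refl

  Triangular-fix₀ : (D : Fin (suc K) → Constraint (suc K) m) → Triangular D →
    Triangular (λ i → fix₀ j (D (suc i)))
  Triangular-fix₀ D tri i u e with D (suc i) in Di
  Triangular-fix₀ D tri i u refl | copy (suc u′) = ≤-pred (tri (suc i) (suc u′) Di)

all-allFin-suc : (n : ℕ) (p : Fin (suc n) → Bool) → all p (allFin (suc n)) ≡ (p zero ∧ all (p ∘ suc) (allFin n))
all-allFin-suc n p = trans (cong (all p) (allFin-suc n))
  (cong (p zero ∧_) (cong Data.Bool.ListAction.and (sym (map-∘ (allFin n)))))

all-cong : {A : Set} {p q : A → Bool} (xs : List A) → (∀ x → p x ≡ q x) → all p xs ≡ all q xs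
all-cong []       h = refl
all-cong (x ∷ xs) h = cong₂ _∧_ (h x) (all-cong xs h)

count-solves : (K m : ℕ) (D : Fin K → Constraint K m) → Triangular D →
  count (solves D) (allFuns K m) ≡ ∏ (freedom ∘ D)
count-solves zero    m D tri = refl
count-solves (suc K) m D tri = first (D zero) refl
  where
  ∏′ = ∏ (freedom ∘ D ∘ suc)
  first : (d : Constraint (suc K) m) → D zero ≡ d → count (solves D) (allFuns (suc K) m) ≡ freedom (D zero) * ∏′
  first (copy u)    D0 with () ← tri zero u D0
  first (within A₀) D0 = begin
    count (solves D) (allFuns (suc K) m)                                 ≡⟨ count-allFuns-suc K m (solves D) ⟩
    sum (map (λ j → count (solves D ∘ consF j) (allFuns K m)) (allFin m)) ≡⟨ sum-map-cong (allFin m) (λ j _ → fibre j) ⟩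
    sum (map (λ j → 𝟙 (A₀ j) * ∏′) (allFin m))                           ≡⟨ sum-map-𝟙* A₀ ∏′ (allFin m) ⟩
    count A₀ (allFin m) * ∏′                                             ≡⟨ cong (λ d → freedom d * ∏′) D0 ⟨
    freedom (D zero) * ∏′                                                ∎
    where
    open ≡-Reasoning
    D′ : Fin m → Fin K → Constraint K m
    D′ j i = fix₀ j (D (suc i))
    solves-cons : ∀ j g → solves D (consF j g) ≡ (A₀ j ∧ solves (D′ j) g)
    solves-cons j g = trans (all-allFin-suc K (λ v → satisfies (D v) (consF j g) (consF j g v)))
      (cong₂ _∧_ (cong (λ d → satisfies d (consF j g) j) D0)
                 (all-cong (allFin K) (λ i → satisfies-fix₀ j g (D (suc i)) (g i))))
    fibre : ∀ j → count (solves D ∘ consF j) (allFuns K m) ≡ 𝟙 (A₀ j) * ∏′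
    fibre j with A₀ j in A₀j
    ... | true = begin
      count (solves D ∘ consF j) (allFuns K m) ≡⟨ count-cong (allFuns K m) (λ g _ → trans (solves-cons j g) (cong (_∧ solves (D′ j) g) A₀j)) ⟩
      count (solves (D′ j)) (allFuns K m)      ≡⟨ count-solves K m (D′ j) (Triangular-fix₀ j D tri) ⟩
      ∏ (freedom ∘ D′ j)                       ≡⟨ ∏-cong (λ i → freedom-fix₀ j (D (suc i))) ⟩
      ∏′                                       ≡⟨ +-identityʳ ∏′ ⟨
      1 * ∏′                                   ∎
    ... | false = count-none (allFuns K m) (λ g _ → trans (solves-cons j g) (cong (_∧ solves (D′ j) g) A₀j))

least : {N : ℕ} → (Fin N → Bool) → Maybe (Fin N)
least {zero}  p = nothing
least {suc N} p = if p zero then just zero else Maybe.map suc (least (p ∘ suc))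

least-just⁻ : {N : ℕ} (p : Fin N → Bool) {u : Fin N} → least p ≡ just u →
  p u ≡ true × (∀ w → toℕ w < toℕ u → p w ≡ false)
least-just⁻ {suc N} p e with p zero in p0
least-just⁻ {suc N} p refl | true = p0 , λ w ()
... | false with least (p ∘ suc) in e′
least-just⁻ {suc N} p refl | false | just u′ with least-just⁻ (p ∘ suc) e′
... | pu′ , below = pu′ , minimal
  where
  minimal : ∀ w → toℕ w < suc (toℕ u′) → p w ≡ false
  minimal zero    _         = p0
  minimal (suc w) (s≤s w<u′) = below w w<u′

least-exists : {N : ℕ} (p : Fin N → Bool) (v : Fin N) → p v ≡ true → ∃[ u ] (least p ≡ just u)
least-exists {suc N} p v pv with p zero in p0
... | true = zero , refl
... | false with v
...   | zero   = ⊥-elim (true≢false pv p0)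
...   | suc v′ with least-exists (p ∘ suc) v′ pv
...     | u , e rewrite e = suc u , refl

least-cong : {N : ℕ} (p q : Fin N → Bool) → (∀ x → p x ≡ q x) → least p ≡ least q
least-cong {zero}  p q h = refl
least-cong {suc N} p q h rewrite h zero | least-cong (p ∘ suc) (q ∘ suc) (h ∘ suc) = refl

module Connectivity {N : ℕ} (F : List (Fin N × Fin N)) where

  Adj : Fin N → Fin N → Set
  Adj a b = (a , b) ∈ F ⊎ (b , a) ∈ F

  Adj-sym : ∀ {a b} → Adj a b → Adj b a
  Adj-sym (inj₁ ab∈) = inj₂ ab∈
  Adj-sym (inj₂ ba∈) = inj₁ ba∈

  reachBy-suc : ∀ k {u v} → reachBy F k u v ≡ true → reachBy F (suc k) u v ≡ true
  reachBy-suc k = ∨-trueˡ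

  reachBy-mono : ∀ {k k′ u v} → k ≤ k′ → reachBy F k u v ≡ true → reachBy F k′ u v ≡ true
  reachBy-mono {k} {u = u} {v} k≤k′ r with m≤n⇒∃[o]m+o≡n k≤k′
  ... | o , refl = go o
    where
    go : ∀ o → reachBy F (k + o) u v ≡ true
    go zero    rewrite +-identityʳ k = r
    go (suc o) rewrite +-suc k o     = reachBy-suc (k + o) (go o)

  reachBy-snoc : ∀ k {u a b} → reachBy F k u a ≡ true → Adj a b → reachBy F (suc k) u b ≡ true
  reachBy-snoc k {u} {a} {b} r (inj₁ ab∈) =
    ∨-trueʳ {reachBy F k u b} (any-true⁺ _ ab∈ (∨-trueˡ (∧-true⁺ r (==-refl b))))
  reachBy-snoc k {u} {a} {b} r (inj₂ ba∈) =
    ∨-trueʳ {reachBy F k u b} (any-true⁺ _ ba∈ (∨-trueʳ {reachBy F k u b ∧ (a == b)} (∧-true⁺ r (==-refl b))))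

  reachBy-suc⁻ : ∀ k {u v} → reachBy F (suc k) u v ≡ true →
    reachBy F k u v ≡ true ⊎ ∃[ a ] (reachBy F k u a ≡ true × Adj a v)
  reachBy-suc⁻ k {u} {v} r with ∨-true⁻ {reachBy F k u v} r
  ... | inj₁ r′ = inj₁ r′
  ... | inj₂ r′ with any-true⁻ _ F r′
  ...   | (x , y) , xy∈ , step with ∨-true⁻ {reachBy F k u x ∧ (y == v)} step
  ...     | inj₁ forward with ∧-true⁻ {reachBy F k u x} forward
  ...       | rx , y=v with refl ← ==⇒≡ {u = y} y=v = inj₂ (x , rx , inj₁ xy∈)
  reachBy-suc⁻ k {u} {v} r | inj₂ r′ | (x , y) , xy∈ , step | inj₂ backward with ∧-true⁻ {reachBy F k u y} backward
  ... | ry , x=v with refl ← ==⇒≡ {u = x} x=v = inj₂ (y , ry , inj₂ xy∈)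

  reachBy-trans : ∀ k₂ k₁ {u a v} → reachBy F k₁ u a ≡ true → reachBy F k₂ a v ≡ true → reachBy F (k₁ + k₂) u v ≡ true
  reachBy-trans zero k₁ {a = a} r₁ r₂ with refl ← ==⇒≡ {u = a} r₂ rewrite +-identityʳ k₁ = r₁
  reachBy-trans (suc k₂) k₁ r₁ r₂ rewrite +-suc k₁ k₂ with reachBy-suc⁻ k₂ r₂
  ... | inj₁ r₂′           = reachBy-suc (k₁ + k₂) (reachBy-trans k₂ k₁ r₁ r₂′)
  ... | inj₂ (b , r₂′ , b~v) = reachBy-snoc (k₁ + k₂) (reachBy-trans k₂ k₁ r₁ r₂′) b~v

  reachBy-cons : ∀ k {u a v} → Adj u a → reachBy F k a v ≡ true → reachBy F (suc k) u v ≡ true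
  reachBy-cons k {u} u~a r = reachBy-trans k 1 (reachBy-snoc 0 (==-refl u) u~a) r

  reachBy-sym : ∀ k {u v} → reachBy F k u v ≡ true → reachBy F k v u ≡ true
  reachBy-sym zero {u} r with refl ← ==⇒≡ {u = u} r = r
  reachBy-sym (suc k) r with reachBy-suc⁻ k r
  ... | inj₁ r′             = reachBy-suc k (reachBy-sym k r′)
  ... | inj₂ (a , r′ , a~v) = reachBy-cons k (Adj-sym a~v) (reachBy-sym k r′)

  -- Walks of length N already reach everything reachable: the reached set grows until it is stable.
  module _ (u : Fin N) where

    reached : ℕ → ℕ
    reached k = count (reachBy F k u) (allFin N)

    Stable : ℕ → Set
    Stable k = ∀ v → reachBy F (suc k) u v ≡ true → reachBy F k u v ≡ true

    stable-suc : ∀ k → Stable k → Stable (suc k)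
    stable-suc k st v r with reachBy-suc⁻ (suc k) r
    ... | inj₁ r′             = r′
    ... | inj₂ (a , r′ , a~v) = reachBy-snoc k (st a r′) a~v

    stable-+ : ∀ k → Stable k → ∀ j v → reachBy F (j + k) u v ≡ true → reachBy F k u v ≡ true
    stable-+ k st zero    v r = r
    stable-+ k st (suc j) v r = stable-+ k st j v (stable-at j v r)
      where
      stable-at : ∀ j → Stable (j + k)
      stable-at zero    = st
      stable-at (suc j) = stable-suc (j + k) (stable-at j)

    stable-or-grows : ∀ k → Stable k ⊎ reached k < reached (suc k)
    stable-or-grows k with all (λ v → not (reachBy F (suc k) u v) ∨ reachBy F k u v) (allFin N) in e
    ... | true = inj₁ λ v r → implied v r (all-true⁻ _ (allFin N) e (∈-allFin v))
      where
      implied : ∀ v → reachBy F (suc k) u v ≡ true → (not (reachBy F (suc k) u v) ∨ reachBy F k u v) ≡ true →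
        reachBy F k u v ≡ true
      implied v r q rewrite r = q
    ... | false with all-false⁻ _ (allFin N) e
    ...   | v , _ , new = inj₂ (count-strict-mono (allFin N) (λ x _ → reachBy-suc k) (∈-allFin v) (old-false new) (new-true new))
      where
      old-false : ∀ {a b} → (not a ∨ b) ≡ false → a ≡ true
      old-false {true} _ = refl
      new-true : ∀ {a b} → (not a ∨ b) ≡ false → b ≡ false
      new-true {true} {false} _ = refl

    stable-or-large : ∀ k → (∃[ k′ ] (k′ ≤ k × Stable k′)) ⊎ k < reached k
    stable-or-large zero = inj₂ (∃⇒count-pos (reachBy F 0 u) (∈-allFin u) (==-refl u))
    stable-or-large (suc k) with stable-or-large k
    ... | inj₁ (k′ , k′≤k , st) = inj₁ (k′ , m≤n⇒m≤1+n k′≤k , st)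
    ... | inj₂ k<r with stable-or-grows k
    ...   | inj₁ st   = inj₁ (k , n≤1+n k , st)
    ...   | inj₂ grow = inj₂ (<-≤-trans (s≤s k<r) grow)

    stable-N : Stable N
    stable-N with stable-or-large N
    ... | inj₂ N<r = ⊥-elim (<⇒≱ N<r (subst (reached N ≤_) (length-allFin N) (count-≤-length _ (allFin N))))
    ... | inj₁ (k′ , k′≤N , st) with m≤n⇒∃[o]m+o≡n k′≤N
    ...   | o , refl = λ v r → reachBy-mono (m≤m+n k′ o)
            (stable-+ k′ st (suc o) v (subst (λ z → reachBy F z u v ≡ true) (cong suc (+-comm k′ o)) r))

    reachBy⇒connected : ∀ k v → reachBy F k u v ≡ true → connected F u v ≡ true
    reachBy⇒connected k v r with ≤-total k N
    ... | inj₁ k≤N = reachBy-mono k≤N r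
    ... | inj₂ N≤k with m≤n⇒∃[o]m+o≡n N≤k
    ...   | o , refl = stable-+ N stable-N o v (subst (λ z → reachBy F z u v ≡ true) (+-comm N o) r)

  connected-refl : ∀ u → connected F u u ≡ true
  connected-refl u = reachBy⇒connected u 0 u (==-refl u)

  connected-sym : ∀ {u v} → connected F u v ≡ true → connected F v u ≡ true
  connected-sym = reachBy-sym N

  connected-trans : ∀ {u a v} → connected F u a ≡ true → connected F a v ≡ true → connected F u v ≡ true
  connected-trans {u} {a} {v} c₁ c₂ = reachBy⇒connected u (N + N) v (reachBy-trans N N c₁ c₂)

  Adj⇒connected : ∀ {a b} → Adj a b → connected F a b ≡ true
  Adj⇒connected {a} {b} a~b = reachBy⇒connected a 1 b (reachBy-snoc 0 (==-refl a) a~b)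

  -- The components are counted by their least vertices, the roots.
  isRoot : Fin N → Bool
  isRoot v = not (any (λ u → (toℕ u <ᵇ toℕ v) ∧ connected F u v) (allFin N))

  isRoot⇒¬connected : ∀ {v} → isRoot v ≡ true → ∀ u → toℕ u < toℕ v → connected F u v ≡ false
  isRoot⇒¬connected {v} e u u<v with connected F u v in c
  ... | false = refl
  ... | true  = ⊥-elim (true≢false (any-true⁺ (λ u → (toℕ u <ᵇ toℕ v) ∧ connected F u v) (∈-allFin u)
                                      (∧-true⁺ (<⇒<ᵇ-true u<v) c)) (not-true⁻ e))

  ¬isRoot⇒connected : ∀ {v} → isRoot v ≡ false → ∃[ u ] (toℕ u < toℕ v × connected F u v ≡ true)
  ¬isRoot⇒connected {v} e with any-true⁻ _ (allFin N) (not-false⁻ e)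
  ... | u , _ , q with ∧-true⁻ {toℕ u <ᵇ toℕ v} q
  ...   | u<v , c = u , <ᵇ-true⇒< u<v , c

  connected⇒¬isRoot : ∀ {u v} → toℕ u < toℕ v → connected F u v ≡ true → isRoot v ≡ false
  connected⇒¬isRoot {u} {v} u<v c with isRoot v in e
  ... | false = refl
  ... | true  = ⊥-elim (true≢false c (isRoot⇒¬connected e u u<v))

  rep : Fin N → Fin N
  rep v = fromMaybe v (least (λ u → connected F u v))

  rep-least : ∀ v → connected F (rep v) v ≡ true × (∀ w → toℕ w < toℕ (rep v) → connected F w v ≡ false)
  rep-least v with least-exists (λ u → connected F u v) v (connected-refl v)
  ... | u , e rewrite e = least-just⁻ (λ u → connected F u v) e

  rep-connected : ∀ v → connected F (rep v) v ≡ true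
  rep-connected v = proj₁ (rep-least v)

  rep-≤ : ∀ v → toℕ (rep v) ≤ toℕ v
  rep-≤ v with ≤-<-connex (toℕ (rep v)) (toℕ v)
  ... | inj₁ ≤v = ≤v
  ... | inj₂ v< = ⊥-elim (true≢false (connected-refl v) (proj₂ (rep-least v) v v<))

  isRoot-rep : ∀ v → isRoot (rep v) ≡ true
  isRoot-rep v with isRoot (rep v) in e
  ... | true  = refl
  ... | false with ¬isRoot⇒connected e
  ...   | u , u< , c = ⊥-elim (true≢false (connected-trans c (rep-connected v)) (proj₂ (rep-least v) u u<))

  rep-isRoot : ∀ v → isRoot v ≡ true → rep v ≡ v
  rep-isRoot v e with m≤n⇒m<n∨m≡n (rep-≤ v)
  ... | inj₂ eq = toℕ-injective eq
  ... | inj₁ lt = ⊥-elim (true≢false (rep-connected v) (isRoot⇒¬connected e (rep v) lt))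

  connected⇒rep≡ : ∀ {a b} → connected F a b ≡ true → rep a ≡ rep b
  connected⇒rep≡ {a} {b} c
    rewrite least-cong (λ u → connected F u a) (λ u → connected F u b)
              (λ u → ≡true-ext (λ ua → connected-trans ua c) (λ ub → connected-trans ub (connected-sym c)))
    with least (λ u → connected F u b) in e
  ... | just u  = refl
  ... | nothing with least-exists (λ u → connected F u b) b (connected-refl b)
  ...   | u , e′ with () ← trans (sym e) e′

  ¬isRoot⇒rep< : ∀ v → isRoot v ≡ false → toℕ (rep v) < toℕ v
  ¬isRoot⇒rep< v e with m≤n⇒m<n∨m≡n (rep-≤ v)
  ... | inj₁ lt = lt
  ... | inj₂ eq = ⊥-elim (true≢false (subst (λ z → isRoot z ≡ true) (toℕ-injective eq) (isRoot-rep v)) e)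

count-∧-not-all : {X Y : Set} (φ : X → Y → Bool) (Q : Y → Bool) (xs : List X) (L : List Y) →
  count (λ y → Q y ∧ not (all (λ x → φ x y) xs)) L ≤ sum (map (λ x → count (λ y → Q y ∧ not (φ x y)) L) xs)
count-∧-not-all φ Q []       L = ≤-reflexive (count-none L (λ y _ → ∧-zeroʳ (Q y)))
count-∧-not-all φ Q (x ∷ xs) L =
  ≤-trans (count-∨ L (λ y _ → split (Q y) (φ x y) (all (λ x → φ x y) xs))) (+-monoʳ-≤ _ (count-∧-not-all φ Q xs L))
  where
  split : ∀ a b c → (a ∧ not (b ∧ c)) ≡ true → (a ∧ not b) ≡ true ⊎ (a ∧ not c) ≡ true
  split true false c    _ = inj₁ refl
  split true true  false _ = inj₂ refl

module _ {N m : ℕ} {M : SimpleGraph N} (H : Cover M m) where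

  straight : Fin N → Fin N → ℕ
  straight a b = count (λ j → hadj H (a , j) (b , j)) (allFin m)

  missing : Fin N × Fin N → ℕ
  missing (a , b) = count (λ j → not (hadj H (a , j) (b , j))) (allFin m)

module Transversals {N m : ℕ} {M : SimpleGraph N} (H : Cover M m) (F : List (Fin N × Fin N)) where
  open Connectivity F

  inSF : (Fin N → Fin m) → Bool
  inSF f = all (inS H f) F

  inSF⇒edge : ∀ f → inSF f ≡ true → ∀ {a b} → (a , b) ∈ F → hadj H (a , f a) (b , f b) ≡ true
  inSF⇒edge f e ab∈ = all-true⁻ (inS H f) F e ab∈

  c : ℕ
  c = components F

  module _ (F⊆M : ∀ {a b} → (a , b) ∈ F → adj M a b ≡ true) where

    -- Matchings propagate agreement of two transversals along the edges of F.
    agree-Adj : ∀ f g → inSF f ≡ true → inSF g ≡ true → ∀ {a v} → Adj a v → f a ≡ g a → f v ≡ g v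
    agree-Adj f g Sf Sg {a} {v} (inj₁ av∈) fa≡ga = matching H a v (f a) (f v) (g v) (F⊆M av∈) (inSF⇒edge f Sf av∈)
      (subst (λ z → hadj H (a , z) (v , g v) ≡ true) (sym fa≡ga) (inSF⇒edge g Sg av∈))
    agree-Adj f g Sf Sg {a} {v} (inj₂ va∈) fa≡ga = matching H a v (f a) (f v) (g v)
      (trans (SimpleGraph.sym M a v) (F⊆M va∈))
      (trans (hsym H _ _) (inSF⇒edge f Sf va∈))
      (subst (λ z → hadj H (a , z) (v , g v) ≡ true) (sym fa≡ga) (trans (hsym H _ _) (inSF⇒edge g Sg va∈)))

    agree-reachBy : ∀ f g → inSF f ≡ true → inSF g ≡ true → ∀ k {u v} → reachBy F k u v ≡ true → f u ≡ g u → f v ≡ g v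
    agree-reachBy f g Sf Sg zero {u} r fu≡gu with refl ← ==⇒≡ {u = u} r = fu≡gu
    agree-reachBy f g Sf Sg (suc k) r fu≡gu with reachBy-suc⁻ k r
    ... | inj₁ r′             = agree-reachBy f g Sf Sg k r′ fu≡gu
    ... | inj₂ (a , r′ , a~v) = agree-Adj f g Sf Sg a~v (agree-reachBy f g Sf Sg k r′ fu≡gu)

    determined-by-roots : Determined m inSF isRoot
    determined-by-roots f g Sf Sg on-roots v = go (suc (toℕ v)) v ≤-refl
      where
      go : ∀ n v → toℕ v < n → f v ≡ g v
      go (suc n) v (s≤s v≤n) with isRoot v in root
      ... | true  = on-roots v root
      ... | false = agree-reachBy f g Sf Sg N (rep-connected v) (go n (rep v) (≤-trans (¬isRoot⇒rep< v root) v≤n))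

    choices-all : ∀ v → choices m isRoot (λ _ _ → true) v ≡ (if isRoot v then m else 1)
    choices-all v = cong (λ z → if isRoot v then z else 1) (trans (count-const-true (allFin m)) (length-allFin m))

    sizeS≤m^c : sizeS H F ≤ m ^ c
    sizeS≤m^c = begin
      sizeS H F                                 ≤⟨ count-determined-≤ N inSF isRoot (λ _ _ → true) (λ _ _ _ _ → refl) determined-by-roots ⟩
      ∏ (choices m isRoot (λ _ _ → true))       ≡⟨ ∏-cong choices-all ⟩
      ∏ (λ v → if isRoot v then m else 1)       ≡⟨ ∏-if m isRoot ⟩
      m ^ c                                     ∎
      where open ≤-Reasoning

    sizeS≤-at-root : (ρ : Fin N) (A₀ : Fin m → Bool) → isRoot ρ ≡ true → (∀ f → inSF f ≡ true → A₀ (f ρ) ≡ true) →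
      sizeS H F ≤ count A₀ (allFin m) * m ^ (c ∸ 1)
    sizeS≤-at-root ρ A₀ root inA₀ = begin
      sizeS H F                                                                   ≤⟨ count-determined-≤ N inSF isRoot A inA determined-by-roots ⟩
      ∏ (choices m isRoot A)                                                      ≡⟨ ∏-cong choices-A ⟩
      ∏ (λ v → if v == ρ then count A₀ (allFin m) else (if isRoot v then m else 1)) ≡⟨ ∏-if-except m _ isRoot ρ root ⟩
      count A₀ (allFin m) * m ^ (c ∸ 1)                                           ∎
      where
      open ≤-Reasoning
      A : Fin N → Fin m → Bool
      A v = if v == ρ then A₀ else (λ _ → true)
      inA : Restricted m inSF isRoot A
      inA f Sf v _ with v == ρ in v=ρ
      ... | true with refl ← ==⇒≡ {u = v} v=ρ = inA₀ f Sf
      ... | false = refl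
      choices-A : ∀ v → choices m isRoot A v ≡ (if v == ρ then count A₀ (allFin m) else (if isRoot v then m else 1))
      choices-A v with v == ρ in v=ρ
      ... | true with refl ← ==⇒≡ {u = v} v=ρ rewrite root = refl
      ... | false = choices-all v

  -- The maps constant on components number m ^ c; each edge of F rules out few of them.
  constantOnComponents : Fin N → Constraint N m
  constantOnComponents v = if isRoot v then within (λ _ → true) else copy (rep v)

  constantOnComponents-triangular : Triangular constantOnComponents
  constantOnComponents-triangular v u e with isRoot v in root
  constantOnComponents-triangular v u refl | false = ¬isRoot⇒rep< v root

  solves⇒constant : ∀ f → solves constantOnComponents f ≡ true → ∀ v → f v ≡ f (rep v)
  solves⇒constant f s v with solves⇒satisfies constantOnComponents f s v
  ... | sat with isRoot v in root
  ...   | true  = cong f (sym (rep-isRoot v root))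
  ...   | false = ==⇒≡ sat

  freedom-constant : ∀ v → freedom (constantOnComponents v) ≡ (if isRoot v then m else 1)
  freedom-constant v with isRoot v
  ... | true  = trans (count-const-true (allFin m)) (length-allFin m)
  ... | false = refl

  count-constant : count (solves constantOnComponents) (allFuns N m) ≡ m ^ c
  count-constant = trans (count-solves N m constantOnComponents constantOnComponents-triangular)
                         (trans (∏-cong freedom-constant) (∏-if m isRoot))

  count-constant-missing : ∀ e → e ∈ F →
    count (λ f → solves constantOnComponents f ∧ not (inS H f e)) (allFuns N m) ≤ missing H e * m ^ (c ∸ 1)
  count-constant-missing (a , b) ab∈ = begin
    count (λ f → solves constantOnComponents f ∧ not (inS H f (a , b))) (allFuns N m) ≤⟨ count-mono (allFuns N m) restrict ⟩
    count (solves D) (allFuns N m)                                                  ≡⟨ count-solves N m D D-triangular ⟩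
    ∏ (freedom ∘ D)                                                                 ≡⟨ ∏-cong freedom-D ⟩
    ∏ (λ v → if v == ρ then missing H (a , b) else (if isRoot v then m else 1))       ≡⟨ ∏-if-except m _ isRoot ρ (isRoot-rep a) ⟩
    missing H (a , b) * m ^ (c ∸ 1)                                                   ∎
    where
    open ≤-Reasoning
    ρ = rep a
    D : Fin N → Constraint N m
    D v = if v == ρ then within (λ j → not (hadj H (a , j) (b , j))) else constantOnComponents v
    D-triangular : Triangular D
    D-triangular v u e with v == ρ
    ... | false = constantOnComponents-triangular v u e
    freedom-D : ∀ v → freedom (D v) ≡ (if v == ρ then missing H (a , b) else (if isRoot v then m else 1))
    freedom-D v with v == ρ
    ... | true  = refl
    ... | false = freedom-constant v
    repb≡ρ : rep b ≡ ρ
    repb≡ρ = sym (connected⇒rep≡ (Adj⇒connected (inj₁ ab∈)))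
    restrict : ∀ f → f ∈ allFuns N m → (solves constantOnComponents f ∧ not (inS H f (a , b))) ≡ true → solves D f ≡ true
    restrict f _ e with ∧-true⁻ {solves constantOnComponents f} e
    ... | s , miss = satisfies⇒solves D f sat
      where
      sat : ∀ v → satisfies (D v) f (f v) ≡ true
      sat v with v == ρ in v=ρ
      ... | true with refl ← ==⇒≡ {u = v} v=ρ =
        subst (λ z → not (hadj H (a , f ρ) (b , z)) ≡ true) (trans (solves⇒constant f s b) (cong f repb≡ρ))
          (subst (λ z → not (hadj H (a , z) (b , f b)) ≡ true) (solves⇒constant f s a) miss)
      ... | false = solves⇒satisfies constantOnComponents f s v

  m^c≤sizeS+missing : m ^ c ≤ sizeS H F + sum (map (missing H) F) * m ^ (c ∸ 1)
  m^c≤sizeS+missing = begin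
    m ^ c                                                                       ≡⟨ count-constant ⟨
    count (solves D) (allFuns N m)                                              ≤⟨ count-∨ (allFuns N m) split ⟩
    sizeS H F + count (λ f → solves D f ∧ not (all (λ e → inS H f e) F)) (allFuns N m)
                                                                                ≤⟨ +-monoʳ-≤ (sizeS H F) (count-∧-not-all (λ e f → inS H f e) (solves D) F (allFuns N m)) ⟩
    sizeS H F + sum (map (λ e → count (λ f → solves D f ∧ not (inS H f e)) (allFuns N m)) F)
                                                                                ≤⟨ +-monoʳ-≤ (sizeS H F) (sum-map-mono F count-constant-missing) ⟩
    sizeS H F + sum (map (λ e → missing H e * m ^ (c ∸ 1)) F)                     ≡⟨ cong (sizeS H F +_) (sum-map-*ʳ _ (missing H) F) ⟩
    sizeS H F + sum (map (missing H) F) * m ^ (c ∸ 1)                               ∎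
    where
    open ≤-Reasoning
    D = constantOnComponents
    split : ∀ f → f ∈ allFuns N m → solves D f ≡ true → inSF f ≡ true ⊎ (solves D f ∧ not (all (λ e → inS H f e) F)) ≡ true
    split f _ s with inSF f
    ... | true  = inj₁ refl
    ... | false rewrite s = inj₂ refl

_<ᶠ_ : {N : ℕ} → Fin N → Fin N → Set
a <ᶠ b = toℕ a < toℕ b

-- the lexicographic order, in which allPairs and hence edges are sorted
_<ₑ_ : {N : ℕ} → Fin N × Fin N → Fin N × Fin N → Set
(a , b) <ₑ (c , d) = (a <ᶠ c) ⊎ (a ≡ c × b <ᶠ d)

<ₑ-irrefl : {N : ℕ} (x : Fin N × Fin N) → x <ₑ x → ⊥
<ₑ-irrefl (a , b) (inj₁ a<a)       = <-irrefl refl a<a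
<ₑ-irrefl (a , b) (inj₂ (_ , b<b)) = <-irrefl refl b<b

<ₑ-trans : {N : ℕ} {x y z : Fin N × Fin N} → x <ₑ y → y <ₑ z → x <ₑ z
<ₑ-trans (inj₁ a<c)          (inj₁ c<e)          = inj₁ (<-trans a<c c<e)
<ₑ-trans (inj₁ a<c)          (inj₂ (refl , _))   = inj₁ a<c
<ₑ-trans (inj₂ (refl , _))   (inj₁ c<e)          = inj₁ c<e
<ₑ-trans (inj₂ (refl , b<d)) (inj₂ (refl , d<f)) = inj₂ (refl , <-trans b<d d<f)

sorted⇒distinct : {A : Set} {R : A → A → Set} → (∀ x → R x x → ⊥) → {xs : List A} →
  AllPairs R xs → AllPairs (λ x y → ¬ (x ≡ y)) xs
sorted⇒distinct irrefl = AllPairs.map (λ {x} x<y x≡y → irrefl x (subst (R′ x) (sym x≡y) x<y))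
  where R′ = λ x y → _

allFin-sorted : (N : ℕ) → AllPairs _<ᶠ_ (allFin N)
allFin-sorted N = AllPairs.tabulate⁺-< id

filterᵇ-sorted : {A : Set} {R : A → A → Set} (p : A → Bool) {xs : List A} → AllPairs R xs → AllPairs R (filterᵇ p xs)
filterᵇ-sorted p = AllPairs.filter⁺ (Data.Bool.T? ∘ p)

module _ {N : ℕ} where

  private
    pairsWith : List (Fin N) → List (Fin N) → List (Fin N × Fin N)
    pairsWith A L = concatMap (λ x → map (x ,_) L) A

    ∈-pairsWith⁻ : (A L : List (Fin N)) {a b : Fin N} → (a , b) ∈ pairsWith A L → a ∈ A × b ∈ L
    ∈-pairsWith⁻ (x ∷ A) L ab∈ with ∈-++⁻ (map (x ,_) L) ab∈
    ... | inj₁ ab∈′ with ∈-map⁻ (x ,_) ab∈′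
    ...   | b′ , b∈ , refl = here refl , b∈
    ∈-pairsWith⁻ (x ∷ A) L ab∈ | inj₂ ab∈′ = map₁ there (∈-pairsWith⁻ A L ab∈′)

    ∈-pairsWith⁺ : (A L : List (Fin N)) {a b : Fin N} → a ∈ A → b ∈ L → (a , b) ∈ pairsWith A L
    ∈-pairsWith⁺ (x ∷ A) L (here refl) b∈ = ∈-++⁺ˡ (∈-map⁺ (x ,_) b∈)
    ∈-pairsWith⁺ (x ∷ A) L (there a∈)  b∈ = ∈-++⁺ʳ (map (x ,_) L) (∈-pairsWith⁺ A L a∈ b∈)

    pairsWith-sorted : (A L : List (Fin N)) → AllPairs _<ᶠ_ A → AllPairs _<ᶠ_ L → AllPairs _<ₑ_ (pairsWith A L)
    pairsWith-sorted []      L _            _  = []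
    pairsWith-sorted (a ∷ A) L (a< ∷ sortA) sortL =
      AllPairs.++⁺ (AllPairs.map⁺ (AllPairs.map (λ b<b′ → inj₂ (refl , b<b′)) sortL)) (pairsWith-sorted A L sortA sortL)
        (All.tabulate λ x∈ → All.tabulate λ y∈ → later x∈ y∈)
      where
      later : ∀ {x y} → x ∈ map (a ,_) L → y ∈ pairsWith A L → x <ₑ y
      later {y = _ , _} x∈ y∈ with ∈-map⁻ (a ,_) x∈ | ∈-pairsWith⁻ A L y∈
      ... | _ , _ , refl | a′∈ , _ = inj₁ (All.lookup a< a′∈)

  ∈-allPairs : (a b : Fin N) → (a , b) ∈ allPairs N
  ∈-allPairs a b = ∈-pairsWith⁺ (allFin N) (allFin N) (∈-allFin a) (∈-allFin b)

  allPairs-sorted : AllPairs _<ₑ_ (allPairs N)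
  allPairs-sorted = pairsWith-sorted (allFin N) (allFin N) (allFin-sorted N) (allFin-sorted N)

  edges-sorted : (Gr : SimpleGraph N) → AllPairs _<ₑ_ (edges Gr)
  edges-sorted Gr = filterᵇ-sorted _ allPairs-sorted

  ∈-edges⁻ : (Gr : SimpleGraph N) {a b : Fin N} → (a , b) ∈ edges Gr → a <ᶠ b × adj Gr a b ≡ true
  ∈-edges⁻ Gr {a} {b} ab∈ with ∧-true⁻ {toℕ a <ᵇ toℕ b} (proj₂ (∈-filterᵇ⁻ _ {allPairs N} ab∈))
  ... | a<b , ab = <ᵇ-true⇒< a<b , ab

module _ {A : Set} where

  ∈-combs⇒⊆ : (k : ℕ) (L : List A) {F : List A} → F ∈ combs k L → ∀ {x} → x ∈ F → x ∈ L
  ∈-combs⇒⊆ zero    L       (here refl) ()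
  ∈-combs⇒⊆ (suc k) (y ∷ L) F∈ x∈ with ∈-++⁻ (map (y ∷_) (combs k L)) F∈
  ... | inj₂ F∈′ = there (∈-combs⇒⊆ (suc k) L F∈′ x∈)
  ... | inj₁ F∈′ with ∈-map⁻ (y ∷_) F∈′ | x∈
  ...   | F′ , F′∈ , refl | here refl = here refl
  ...   | F′ , F′∈ , refl | there x∈′ = there (∈-combs⇒⊆ k L F′∈ x∈′)

  ∈-combs⇒length : (k : ℕ) (L : List A) {F : List A} → F ∈ combs k L → length F ≡ k
  ∈-combs⇒length zero    L       (here refl) = refl
  ∈-combs⇒length (suc k) (y ∷ L) F∈ with ∈-++⁻ (map (y ∷_) (combs k L)) F∈
  ... | inj₂ F∈′ = ∈-combs⇒length (suc k) L F∈′
  ... | inj₁ F∈′ with ∈-map⁻ (y ∷_) F∈′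
  ...   | F′ , F′∈ , refl = cong suc (∈-combs⇒length k L F′∈)

  ∈-combs⇒sorted : {R : A → A → Set} (k : ℕ) (L : List A) {F : List A} → AllPairs R L → F ∈ combs k L → AllPairs R F
  ∈-combs⇒sorted zero    L       _          (here refl) = []
  ∈-combs⇒sorted (suc k) (y ∷ L) (y< ∷ sortL) F∈ with ∈-++⁻ (map (y ∷_) (combs k L)) F∈
  ... | inj₂ F∈′ = ∈-combs⇒sorted (suc k) L sortL F∈′
  ... | inj₁ F∈′ with ∈-map⁻ (y ∷_) F∈′
  ...   | F′ , F′∈ , refl = All.tabulate (λ x∈ → All.lookup y< (∈-combs⇒⊆ k L F′∈ x∈)) ∷ ∈-combs⇒sorted k L sortL F′∈

  combs-distinct : {R : A → A → Set} → (∀ x → R x x → ⊥) → (k : ℕ) (L : List A) → AllPairs R L →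
    AllPairs (λ x y → ¬ (x ≡ y)) (combs k L)
  combs-distinct irrefl zero    L       _            = [] ∷ []
  combs-distinct irrefl (suc k) []      _            = []
  combs-distinct irrefl (suc k) (y ∷ L) (y< ∷ sortL) =
    AllPairs.++⁺ (AllPairs.map⁺ (AllPairs.map (λ F≢F′ → F≢F′ ∘ ∷-injectiveʳ) (combs-distinct irrefl k L sortL)))
      (combs-distinct irrefl (suc k) L sortL) (All.tabulate λ F∈ → All.tabulate λ F′∈ → with≢without F∈ F′∈)
    where
    ∷-injectiveʳ : ∀ {a b : List A} → y ∷ a ≡ y ∷ b → a ≡ b
    ∷-injectiveʳ refl = refl
    with≢without : ∀ {F F′} → F ∈ map (y ∷_) (combs k L) → F′ ∈ combs (suc k) L → ¬ (F ≡ F′)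
    with≢without {F′ = []} _ F′∈ _ with () ← ∈-combs⇒length (suc k) L F′∈
    with≢without {F′ = _ ∷ _} F∈ F′∈ F≡F′ with ∈-map⁻ (y ∷_) F∈
    ... | _ , _ , refl with refl ← F≡F′ = irrefl y (All.lookup y< (∈-combs⇒⊆ (suc k) L F′∈ (here refl)))

  length-combs : (k : ℕ) (L : List A) → length (combs k L) ≡ length L C k
  length-combs zero    []      = refl
  length-combs zero    (x ∷ L) = refl
  length-combs (suc k) []      = refl
  length-combs (suc k) (x ∷ L) = trans (length-++ (map (x ∷_) (combs k L)))
    (trans (cong₂ _+_ (trans (length-map (x ∷_) (combs k L)) (length-combs k L)) (length-combs (suc k) L))
           (nCk+nC[k+1]≡[n+1]C[k+1] (length L) k))

combs-map : {A B : Set} (f : A → B) (k : ℕ) (L : List A) → combs k (map f L) ≡ map (map f) (combs k L)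
combs-map f zero    L       = refl
combs-map f (suc k) []      = refl
combs-map f (suc k) (x ∷ L) = begin
  map (f x ∷_) (combs k (map f L)) ++ combs (suc k) (map f L)         ≡⟨ cong₂ _++_ (cong (map (f x ∷_)) (combs-map f k L)) (combs-map f (suc k) L) ⟩
  map (f x ∷_) (map (map f) (combs k L)) ++ map (map f) (combs (suc k) L) ≡⟨ cong (_++ map (map f) (combs (suc k) L)) (trans (sym (map-∘ (combs k L))) (map-∘ (combs k L))) ⟩
  map (map f) (map (x ∷_) (combs k L)) ++ map (map f) (combs (suc k) L) ≡⟨ map-++ (map f) (map (x ∷_) (combs k L)) (combs (suc k) L) ⟨
  map (map f) (map (x ∷_) (combs k L) ++ combs (suc k) L)               ∎
  where open ≡-Reasoning

sorted⇒∈-combs-allFin : (N : ℕ) (xs : List (Fin N)) → AllPairs _<ᶠ_ xs → xs ∈ combs (length xs) (allFin N)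
sorted⇒∈-combs-allFin zero    []       _           = here refl
sorted⇒∈-combs-allFin (suc N) []       _           = here refl
sorted⇒∈-combs-allFin (suc N) (x ∷ xs) (x< ∷ sortxs) =
  subst (λ L → (x ∷ xs) ∈ combs (suc (length xs)) L) (sym (allFin-suc N)) (head x x<)
  where
  unsuc : (ys : List (Fin (suc N))) → All (λ y → 0 < toℕ y) ys → ∃[ zs ] (ys ≡ map suc zs)
  unsuc []           _          = [] , refl
  unsuc (suc y ∷ ys) (_ ∷ pos) with unsuc ys pos
  ... | zs , refl = y ∷ zs , refl
  unsuc-sorted : (zs : List (Fin N)) → AllPairs _<ᶠ_ (map suc zs) → AllPairs _<ᶠ_ zs
  unsuc-sorted zs s = AllPairs.map (λ { (s≤s lt) → lt }) (AllPairs.map⁻ s)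
  shifted : (zs : List (Fin N)) (k : ℕ) → length zs ≡ k → AllPairs _<ᶠ_ (map suc zs) → map suc zs ∈ combs k (map suc (allFin N))
  shifted zs k refl s = subst (map suc zs ∈_) (sym (combs-map suc (length zs) (allFin N)))
    (∈-map⁺ (map suc) (sorted⇒∈-combs-allFin N zs (unsuc-sorted zs s)))
  head : ∀ x → All (x <ᶠ_) xs → (x ∷ xs) ∈ combs (suc (length xs)) (zero ∷ map suc (allFin N))
  head zero x< with unsuc xs x<
  ... | zs , refl = ∈-++⁺ˡ (∈-map⁺ (zero ∷_) (shifted zs (length (map suc zs)) (sym (length-map suc zs)) sortxs))
  head (suc x′) x< with unsuc (suc x′ ∷ xs) (s≤s z≤n ∷ All.map (<-trans (s≤s z≤n)) x<)
  ... | zs , eq = subst (_∈ combs (suc (length xs)) (zero ∷ map suc (allFin N))) (sym eq)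
    (∈-++⁺ʳ (map (zero ∷_) (combs (length xs) (map suc (allFin N))))
      (shifted zs (suc (length xs)) (trans (sym (length-map suc zs)) (sym (cong length eq)))
        (subst (AllPairs _<ᶠ_) eq (x< ∷ sortxs))))

count-allPairs : {N : ℕ} (φ : Fin N × Fin N → Bool) →
  count φ (allPairs N) ≡ sum (map (λ a → count (λ b → φ (a , b)) (allFin N)) (allFin N))
count-allPairs {N} φ = trans (count-concatMap φ _ (allFin N)) (sum-map-cong (allFin N) (λ a _ → count-map φ (a ,_) (allFin N)))

count-∧-const : {X : Set} (b : Bool) (q : X → Bool) (xs : List X) → count (λ x → b ∧ q x) xs ≡ 𝟙 b * count q xs
count-∧-const true  q xs = sym (+-identityʳ _)
count-∧-const false q xs = count-none xs (λ _ _ → refl)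

suc-C-2 : ∀ b r → (𝟙 b + r) C 2 ≡ 𝟙 b * r + r C 2
suc-C-2 true  r = trans (sym (nCk+nC[k+1]≡[n+1]C[k+1] r 1)) (cong (_+ r C 2) (trans (nC1≡n r) (sym (+-identityʳ r))))
suc-C-2 false r = refl

C2-mono : ∀ {a b} → a ≤ b → a C 2 ≤ b C 2
C2-mono {a} {zero}  z≤n = ≤-refl
C2-mono {a} {suc b} a≤sb with m≤n⇒m<n∨m≡n a≤sb
... | inj₂ refl      = ≤-refl
... | inj₁ (s≤s a≤b) = ≤-trans (C2-mono a≤b)
  (≤-trans (m≤n+m (b C 2) b) (≤-reflexive (sym (trans (suc-C-2 true b) (cong (_+ b C 2) (*-identityˡ b))))))

count-pairs-within : (N : ℕ) (p : Fin N → Bool) →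
  sum (map (λ a → count (λ b → (toℕ a <ᵇ toℕ b) ∧ (p a ∧ p b)) (allFin N)) (allFin N)) ≡ count p (allFin N) C 2
count-pairs-within zero    p = refl
count-pairs-within (suc N) p = begin
  sum (map (λ a → count (pair a) (allFin (suc N))) (allFin (suc N)))
    ≡⟨ sum-allFin-suc N (λ a → count (pair a) (allFin (suc N))) ⟩
  count (pair zero) (allFin (suc N)) + sum (map (λ a → count (pair (suc a)) (allFin (suc N))) (allFin N))
    ≡⟨ cong₂ _+_ (trans (count-allFin-suc N (pair zero)) (count-∧-const (p zero) (p ∘ suc) (allFin N)))
                 (trans (sum-map-cong (allFin N) (λ a _ → count-allFin-suc N (pair (suc a))))
                        (count-pairs-within N (p ∘ suc))) ⟩
  𝟙 (p zero) * count (p ∘ suc) (allFin N) + count (p ∘ suc) (allFin N) C 2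
    ≡⟨ suc-C-2 (p zero) _ ⟨
  (𝟙 (p zero) + count (p ∘ suc) (allFin N)) C 2
    ≡⟨ cong (_C 2) (count-allFin-suc N p) ⟨
  count p (allFin (suc N)) C 2 ∎
  where
  open ≡-Reasoning
  pair : Fin (suc N) → Fin (suc N) → Bool
  pair a b = (toℕ a <ᵇ toℕ b) ∧ (p a ∧ p b)

module Rank {N : ℕ} (F : List (Fin N × Fin N)) where
  open Connectivity F

  nonRoot : Fin N → Bool
  nonRoot v = not (isRoot v)

  r : ℕ
  r = count nonRoot (allFin N)

  components+r≡N : components F + r ≡ N
  components+r≡N = trans (count+count-not isRoot (allFin N)) (length-allFin N)

  module _ (F-< : ∀ {a b} → (a , b) ∈ F → a <ᶠ b) where

    ∈F⇒nonRoot : ∀ {a b} → (a , b) ∈ F → isRoot b ≡ false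
    ∈F⇒nonRoot ab∈ = connected⇒¬isRoot (F-< ab∈) (Adj⇒connected (inj₁ ab∈))

    ∈F⇒rep≡ : ∀ {a b} → (a , b) ∈ F → isRoot a ≡ true → rep b ≡ a
    ∈F⇒rep≡ ab∈ root = trans (sym (connected⇒rep≡ (Adj⇒connected (inj₁ ab∈)))) (rep-isRoot _ root)

    -- Every edge joins two non-roots, or a non-root to its representative.
    withinNonRoots toRep : Fin N × Fin N → Bool
    withinNonRoots (a , b) = (toℕ a <ᵇ toℕ b) ∧ (nonRoot a ∧ nonRoot b)
    toRep          (a , b) = nonRoot b ∧ (a == rep b)

    ∈F⇒edge-type : ∀ {a b} → (a , b) ∈ F → (withinNonRoots (a , b) ∨ toRep (a , b)) ≡ true
    ∈F⇒edge-type {a} {b} ab∈ with isRoot a in root-a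
    ... | false rewrite ∈F⇒nonRoot ab∈ = ∨-trueˡ (∧-true⁺ (<⇒<ᵇ-true (F-< ab∈)) refl)
    ... | true  rewrite ∈F⇒nonRoot ab∈ | ∈F⇒rep≡ ab∈ root-a = ∨-trueʳ {(toℕ a <ᵇ toℕ b) ∧ false} (==-refl a)

    count-toRep : count toRep (allPairs N) ≡ r
    count-toRep = begin
      count toRep (allPairs N)                                                   ≡⟨ count-allPairs toRep ⟩
      sum (map (λ a → count (λ b → toRep (a , b)) (allFin N)) (allFin N))         ≡⟨ sum-map-cong (allFin N) (λ a _ → sym (sum-map-𝟙 (λ b → toRep (a , b)) (allFin N))) ⟩
      sum (map (λ a → sum (map (λ b → 𝟙 (toRep (a , b))) (allFin N))) (allFin N)) ≡⟨ sum-swap (λ a b → 𝟙 (toRep (a , b))) (allFin N) (allFin N) ⟩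
      sum (map (λ b → sum (map (λ a → 𝟙 (toRep (a , b))) (allFin N))) (allFin N)) ≡⟨ sum-map-cong (allFin N) (λ b _ → one-rep b) ⟩
      sum (map (λ b → 𝟙 (nonRoot b)) (allFin N))                                  ≡⟨ sum-map-𝟙 nonRoot (allFin N) ⟩
      r                                                                            ∎
      where
      open ≡-Reasoning
      one-rep : ∀ b → sum (map (λ a → 𝟙 (toRep (a , b))) (allFin N)) ≡ 𝟙 (nonRoot b)
      one-rep b = trans (sum-map-𝟙 (λ a → toRep (a , b)) (allFin N))
        (trans (count-∧-const (nonRoot b) (_== rep b) (allFin N))
               (trans (cong (𝟙 (nonRoot b) *_) (count-==-allFin N (rep b))) (*-identityʳ _)))

    length≤suc-r-C-2 : AllPairs (λ x y → ¬ (x ≡ y)) F → length F ≤ suc r C 2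
    length≤suc-r-C-2 F! = begin
      length F                                                      ≤⟨ length-≤-injection F (filterᵇ edgeType (allPairs N)) id F!
                                                                         (λ { (a , b) ab∈ → ∈-filterᵇ⁺ edgeType (∈-allPairs a b) (∈F⇒edge-type ab∈) })
                                                                         (λ _ _ _ _ e → e) ⟩
      count edgeType (allPairs N)                                   ≤⟨ count-∨ (allPairs N) (λ x _ → ∨-true⁻ {withinNonRoots x}) ⟩
      count withinNonRoots (allPairs N) + count toRep (allPairs N)  ≡⟨ cong₂ _+_ (trans (count-allPairs withinNonRoots) (count-pairs-within N nonRoot)) count-toRep ⟩
      r C 2 + r                                                     ≡⟨ cong₂ _+_ refl (+-identityʳ r) ⟨
      r C 2 + 𝟙 true * r                                            ≡⟨ +-comm (r C 2) _ ⟩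
      𝟙 true * r + r C 2                                            ≡⟨ suc-C-2 true r ⟨
      suc r C 2                                                     ∎
      where
      open ≤-Reasoning
      edgeType : Fin N × Fin N → Bool
      edgeType x = withinNonRoots x ∨ toRep x

  -- Each non-root b is joined by an edge of F to a vertex closer to rep b, so r ≤ |F|.
  module _ (b : Fin N) where

    private
      reachesFromRep : Fin (suc N) → Bool
      reachesFromRep k = reachBy F (toℕ k) (rep b) b

      shortest : ∃[ k ] (least reachesFromRep ≡ just k)
      shortest = least-exists reachesFromRep (fromℕ N)
        (subst (λ z → reachBy F z (rep b) b ≡ true) (sym (toℕ-fromℕ N)) (rep-connected b))

    dist : ℕ
    dist = toℕ (proj₁ shortest)

    dist-reaches : reachBy F dist (rep b) b ≡ true
    dist-reaches = proj₁ (least-just⁻ reachesFromRep (proj₂ shortest))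

    dist-minimal : ∀ k → reachBy F k (rep b) b ≡ true → dist ≤ k
    dist-minimal k reaches with ≤-<-connex dist k
    ... | inj₁ ≤k = ≤k
    ... | inj₂ k< = ⊥-elim (true≢false (subst (λ z → reachBy F z (rep b) b ≡ true) (sym (toℕ-fromℕ< k<N)) reaches)
                               (proj₂ (least-just⁻ reachesFromRep (proj₂ shortest)) (fromℕ< k<N)
                                 (subst (_< dist) (sym (toℕ-fromℕ< k<N)) k<)))
      where
      k<N : k < suc N
      k<N = <-≤-trans k< (toℕ≤n (proj₁ shortest))

    ¬isRoot⇒dist-pos : isRoot b ≡ false → 0 < dist
    ¬isRoot⇒dist-pos nonroot with dist | dist-reaches
    ... | suc _ | _ = s≤s z≤n
    ... | zero  | r₀ = ⊥-elim (<-irrefl (cong toℕ (==⇒≡ {u = rep b} r₀)) (¬isRoot⇒rep< b nonroot))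

    IsParentEdge : Fin N × Fin N → Set
    IsParentEdge e = e ∈ F × Σ (Fin N) λ a → (e ≡ (a , b) ⊎ e ≡ (b , a)) × reachBy F (Data.Nat.pred dist) (rep b) a ≡ true

    parentEdge-exists : isRoot b ≡ false → Σ (Fin N × Fin N) IsParentEdge
    parentEdge-exists nonroot = go dist refl (¬isRoot⇒dist-pos nonroot)
      where
      go : ∀ d → dist ≡ d → 0 < d → Σ (Fin N × Fin N) IsParentEdge
      go (suc d) dist≡ _ with reachBy-suc⁻ d (subst (λ z → reachBy F z (rep b) b ≡ true) dist≡ dist-reaches)
      ... | inj₁ r′ = ⊥-elim (<-irrefl refl (≤-trans (≤-reflexive (sym dist≡)) (dist-minimal d r′)))
      ... | inj₂ (a , ra , inj₁ ab∈) = (a , b) , ab∈ , a , inj₁ refl , subst (λ z → reachBy F (Data.Nat.pred z) (rep b) a ≡ true) (sym dist≡) ra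
      ... | inj₂ (a , ra , inj₂ ba∈) = (b , a) , ba∈ , a , inj₂ refl , subst (λ z → reachBy F (Data.Nat.pred z) (rep b) a ≡ true) (sym dist≡) ra

  -- junk value (b , b) at roots
  parentEdgeAt : (b : Fin N) (t : Bool) → isRoot b ≡ t → Fin N × Fin N
  parentEdgeAt b true  _       = (b , b)
  parentEdgeAt b false nonroot = proj₁ (parentEdge-exists b nonroot)

  parentEdge : Fin N → Fin N × Fin N
  parentEdge b = parentEdgeAt b (isRoot b) refl

  parentEdge-spec : ∀ b → isRoot b ≡ false → IsParentEdge b (parentEdge b)
  parentEdge-spec b = go (isRoot b) refl
    where
    go : ∀ t (e : isRoot b ≡ t) → t ≡ false → IsParentEdge b (parentEdgeAt b t e)
    go false e _ = proj₂ (parentEdge-exists b e)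

  r≤length : r ≤ length F
  r≤length = length-≤-injection (filterᵇ nonRoot (allFin N)) F parentEdge
    (sorted⇒distinct (λ _ → <-irrefl refl) (filterᵇ-sorted nonRoot (allFin-sorted N)))
    (λ b b∈ → proj₁ (parentEdge-spec b (nonRoot∈ b∈)))
    injective
    where
    nonRoot∈ : ∀ {b} → b ∈ filterᵇ nonRoot (allFin N) → isRoot b ≡ false
    nonRoot∈ b∈ = not-true⁻ (proj₂ (∈-filterᵇ⁻ nonRoot {allFin N} b∈))
    other-end : ∀ {b b′ a a′ : Fin N} {e : Fin N × Fin N} → ¬ (b ≡ b′) →
      (e ≡ (a , b) ⊎ e ≡ (b , a)) → (e ≡ (a′ , b′) ⊎ e ≡ (b′ , a′)) → a ≡ b′ × a′ ≡ b
    other-end b≢b′ (inj₁ refl) (inj₁ refl) = ⊥-elim (b≢b′ refl)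
    other-end b≢b′ (inj₁ refl) (inj₂ refl) = refl , refl
    other-end b≢b′ (inj₂ refl) (inj₁ refl) = refl , refl
    other-end b≢b′ (inj₂ refl) (inj₂ refl) = ⊥-elim (b≢b′ refl)
    ends-Adj : ∀ {b a : Fin N} {e : Fin N × Fin N} → e ∈ F → (e ≡ (a , b) ⊎ e ≡ (b , a)) → Adj a b
    ends-Adj e∈ (inj₁ refl) = inj₁ e∈
    ends-Adj e∈ (inj₂ refl) = inj₂ e∈
    -- two vertices cannot each be strictly closer to the common representative than the other
    no-mutual : ∀ {x y} → 0 < x → 0 < y → y ≤ Data.Nat.pred x → x ≤ Data.Nat.pred y → ⊥
    no-mutual {suc x} {suc y} _ _ y≤x x≤y = <-irrefl refl (≤-trans (s≤s y≤x) (m≤n⇒m≤1+n x≤y))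
    injective : ∀ b b′ → b ∈ filterᵇ nonRoot (allFin N) → b′ ∈ filterᵇ nonRoot (allFin N) → parentEdge b ≡ parentEdge b′ → b ≡ b′
    injective b b′ b∈ b′∈ same with b ≟F b′
    ... | yes b≡b′ = b≡b′
    ... | no b≢b′ with parentEdge-spec b (nonRoot∈ b∈) | parentEdge-spec b′ (nonRoot∈ b′∈)
    ...   | e∈ , a , ends , ra | _ , a′ , ends′ , ra′
      with other-end b≢b′ ends (subst (λ z → z ≡ (a′ , b′) ⊎ z ≡ (b′ , a′)) (sym same) ends′)
    ...     | refl , refl = ⊥-elim (no-mutual (¬isRoot⇒dist-pos b (nonRoot∈ b∈)) (¬isRoot⇒dist-pos b′ (nonRoot∈ b′∈))
                 (dist-minimal b′ _ (subst (λ z → reachBy F (Data.Nat.pred (dist b)) z b′ ≡ true) rep≡ ra))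
                 (dist-minimal b _ (subst (λ z → reachBy F (Data.Nat.pred (dist b′)) z b ≡ true) (sym rep≡) ra′)))
      where
      rep≡ : rep b ≡ rep b′
      rep≡ = connected⇒rep≡ (Adj⇒connected (Adj-sym (ends-Adj e∈ ends)))

  components≡N∸r : components F ≡ N ∸ r
  components≡N∸r = trans (sym (m+n∸n≡m _ r)) (cong (_∸ r) components+r≡N)

  components≤N∸ : ∀ {k} → k ≤ r → components F ≤ N ∸ k
  components≤N∸ k≤r = ≤-trans (≤-reflexive components≡N∸r) (∸-monoʳ-≤ N k≤r)

  module _ (F-< : ∀ {a b} → (a , b) ∈ F → a <ᶠ b) (F! : AllPairs (λ x y → ¬ (x ≡ y)) F) where

    long⇒r> : ∀ j → suc j C 2 < length F → j < r
    long⇒r> j long with ≤-<-connex r j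
    ... | inj₂ j<r = j<r
    ... | inj₁ r≤j = ⊥-elim (<⇒≱ long (≤-trans (length≤suc-r-C-2 F-< F!) (C2-mono (s≤s r≤j))))

sorted-triple-elements : {X : Set} {R : X → X → Set} → (∀ x → R x x → ⊥) → (∀ {x y z} → R x y → R y z → R x z) →
  {e₁ e₂ e₃ x y z : X} → R e₁ e₂ → R e₂ e₃ → R x y → R y z →
  x ∈ e₁ ∷ e₂ ∷ e₃ ∷ [] → y ∈ e₁ ∷ e₂ ∷ e₃ ∷ [] → z ∈ e₁ ∷ e₂ ∷ e₃ ∷ [] → x ≡ e₁ × y ≡ e₂ × z ≡ e₃
sorted-triple-elements {R = R} irr tr {e₁} {e₂} {e₃} e₁e₂ e₂e₃ xy yz x∈ y∈ z∈ = go x∈ y∈ z∈ xy yz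
  where
  E = e₁ ∷ e₂ ∷ e₃ ∷ []
  ¬above-e₃ : ∀ {w} → w ∈ E → R e₃ w → ⊥
  ¬above-e₃ (here refl)                 e₃w = irr _ (tr (tr e₁e₂ e₂e₃) e₃w)
  ¬above-e₃ (there (here refl))         e₃w = irr _ (tr e₂e₃ e₃w)
  ¬above-e₃ (there (there (here refl))) e₃w = irr _ e₃w
  above-e₂ : ∀ {w} → w ∈ E → R e₂ w → w ≡ e₃
  above-e₂ (here refl)                 e₂w = ⊥-elim (irr _ (tr e₁e₂ e₂w))
  above-e₂ (there (here refl))         e₂w = ⊥-elim (irr _ e₂w)
  above-e₂ (there (there (here refl))) _   = refl
  go : ∀ {x y z} → x ∈ E → y ∈ E → z ∈ E → R x y → R y z → x ≡ e₁ × y ≡ e₂ × z ≡ e₃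
  go (here refl) (here refl)                 _  xy _  = ⊥-elim (irr _ xy)
  go (here refl) (there (here refl))         z∈ _  yz = refl , refl , above-e₂ z∈ yz
  go (here refl) (there (there (here refl))) z∈ _  yz = ⊥-elim (¬above-e₃ z∈ yz)
  go (there (here refl))         y∈ z∈ xy yz with refl ← above-e₂ y∈ xy = ⊥-elim (¬above-e₃ z∈ yz)
  go (there (there (here refl))) y∈ _  xy _  = ⊥-elim (¬above-e₃ y∈ xy)

sorted-triple : {X : Set} {R : X → X → Set} → (∀ x → R x x → ⊥) → (∀ {x y z} → R x y → R y z → R x z) →
  {e₁ e₂ e₃ : X} → R e₁ e₂ → R e₂ e₃ → (L : List X) → length L ≡ 3 → AllPairs R L →
  (∀ {x} → x ∈ L → x ∈ e₁ ∷ e₂ ∷ e₃ ∷ []) → L ≡ e₁ ∷ e₂ ∷ e₃ ∷ []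
sorted-triple irr tr e₁e₂ e₂e₃ (x ∷ y ∷ z ∷ []) _ ((xy ∷ _) ∷ (yz ∷ []) ∷ [] ∷ []) ⊆E
  with sorted-triple-elements irr tr e₁e₂ e₂e₃ xy yz (⊆E (here refl)) (⊆E (there (here refl))) (⊆E (there (there (here refl))))
... | refl , refl , refl = refl

module TriangleShape {N : ℕ} (M : SimpleGraph N) (F : List (Fin N × Fin N))
                     (F⊆E : ∀ {e} → e ∈ F → e ∈ edges M) (F-sorted : AllPairs _<ₑ_ F) where
  open Connectivity F
  open Rank F

  F-< : ∀ {a b} → (a , b) ∈ F → a <ᶠ b
  F-< ab∈ = proj₁ (∈-edges⁻ M (F⊆E ab∈))

  F! : AllPairs (λ x y → ¬ (x ≡ y)) F
  F! = sorted⇒distinct <ₑ-irrefl F-sorted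

  NonRootPair : Fin N → Fin N → Set
  NonRootPair p q = p <ᶠ q × isRoot p ≡ false × isRoot q ≡ false × (∀ v → isRoot v ≡ false → v ≡ p ⊎ v ≡ q)

  r≡2⇒nonRootPair : r ≡ 2 → Σ (Fin N) λ p → Σ (Fin N) λ q → NonRootPair p q
  r≡2⇒nonRootPair r≡2 with filterᵇ nonRoot (allFin N) in nonRoots | filterᵇ-sorted {R = _<ᶠ_} nonRoot (allFin-sorted N)
  ... | p ∷ q ∷ [] | (p<q ∷ []) ∷ _ =
    p , q , p<q , not-true⁻ (proj₂ (∈-filterᵇ⁻ nonRoot {allFin N} (∈nonRoots (here refl))))
                , not-true⁻ (proj₂ (∈-filterᵇ⁻ nonRoot {allFin N} (∈nonRoots (there (here refl)))))
                , λ v nr → p-or-q (subst (v ∈_) nonRoots (∈-filterᵇ⁺ nonRoot (∈-allFin v) (cong not nr)))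
    where
    ∈nonRoots : ∀ {v} → v ∈ p ∷ q ∷ [] → v ∈ filterᵇ nonRoot (allFin N)
    ∈nonRoots = subst (_ ∈_) (sym nonRoots)
    p-or-q : ∀ {v} → v ∈ p ∷ q ∷ [] → v ≡ p ⊎ v ≡ q
    p-or-q (here v≡p)         = inj₁ v≡p
    p-or-q (there (here v≡q)) = inj₂ v≡q
  r≡2⇒nonRootPair () | []                | _
  r≡2⇒nonRootPair () | _ ∷ []            | _
  r≡2⇒nonRootPair () | _ ∷ _ ∷ _ ∷ _     | _

  module _ {p q : Fin N} (pq : NonRootPair p q) where

    private
      p<q = proj₁ pq
      only-p-q = proj₂ (proj₂ (proj₂ pq))

    ∈F⇒candidate : ∀ {e} → e ∈ F → e ∈ (rep p , p) ∷ (rep q , q) ∷ (p , q) ∷ []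
    ∈F⇒candidate {a , b} ab∈ with only-p-q b (∈F⇒nonRoot F-< ab∈) | isRoot a in root-a
    ... | inj₁ refl | true = here (cong (_, b) (sym (∈F⇒rep≡ F-< ab∈ root-a)))
    ... | inj₂ refl | true = there (here (cong (_, b) (sym (∈F⇒rep≡ F-< ab∈ root-a))))
    ... | inj₁ refl | false with only-p-q a root-a
    ...   | inj₁ refl = ⊥-elim (<-irrefl refl (F-< ab∈))
    ...   | inj₂ refl = ⊥-elim (<-asym p<q (F-< ab∈))
    ∈F⇒candidate {a , b} ab∈ | inj₂ refl | false with only-p-q a root-a
    ... | inj₁ refl = there (there (here refl))
    ... | inj₂ refl = ⊥-elim (<-irrefl refl (F-< ab∈))

    -- otherwise the three distinct edges would lie in a two-element set
    length3⇒rep≡ : length F ≡ 3 → rep p ≡ rep q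
    length3⇒rep≡ len with rep p ≟F rep q
    ... | yes rep≡ = rep≡
    ... | no rep≢ = ⊥-elim (3≰2 (subst (_≤ 2) len (length-≤-injection F two id F! (λ _ → ∈two) (λ _ _ _ _ e → e))))
      where
      3≰2 : ¬ (3 ≤ 2)
      3≰2 (s≤s (s≤s ()))
      two = (rep p , p) ∷ (rep q , q) ∷ []
      ∈two : ∀ {e} → e ∈ F → e ∈ two
      ∈two e∈ with ∈F⇒candidate e∈
      ... | here e≡              = here e≡
      ... | there (here e≡)      = there (here e≡)
      ... | there (there (here refl)) = ⊥-elim (rep≢ (connected⇒rep≡ (Adj⇒connected (inj₁ e∈))))

  Triangle : Fin N → Fin N → Fin N → Set
  Triangle a p q = a <ᶠ p × p <ᶠ q × F ≡ (a , p) ∷ (a , q) ∷ (p , q) ∷ []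

  length3⇒triangle : length F ≡ 3 → r ≡ 2 → Σ (Fin N) λ a → Σ (Fin N) λ p → Σ (Fin N) λ q → Triangle a p q
  length3⇒triangle len r≡2 with r≡2⇒nonRootPair r≡2
  ... | p , q , pq@(p<q , nonroot-p , _) = a , p , q , a<p , p<q ,
    sorted-triple <ₑ-irrefl <ₑ-trans (inj₂ (refl , p<q)) (inj₁ a<p) F len F-sorted
      (λ e∈ → subst (λ b → _ ∈ (a , p) ∷ (b , q) ∷ (p , q) ∷ []) (sym (length3⇒rep≡ pq len)) (∈F⇒candidate pq e∈))
    where
    a = rep p
    a<p : a <ᶠ p
    a<p = ¬isRoot⇒rep< p nonroot-p

sum-edges : {n : ℕ} (Gr : SimpleGraph n) (φ : Fin n × Fin n → ℕ) →
  sum (map φ (edges Gr)) ≡ sum (map (λ a → sum (map (λ b → 𝟙 ((toℕ a <ᵇ toℕ b) ∧ adj Gr a b) * φ (a , b)) (allFin n))) (allFin n))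
sum-edges {n} Gr φ = trans (sum-map-filterᵇ _ φ (allPairs n))
  (trans (sum-map-concatMap _ _ (allFin n)) (sum-map-cong (allFin n) (λ a _ → sum-map-map _ (a ,_) (allFin n))))

sum-edges-join : {k : ℕ} (G : SimpleGraph k) (φ : Fin (suc k) × Fin (suc k) → ℕ) →
  sum (map φ (edges (K1∨ G))) ≡ sum (map (λ v → φ (zero , suc v)) (allFin k)) + sum (map (λ (u , v) → φ (suc u , suc v)) (edges G))
sum-edges-join {k} G φ = begin
  sum (map φ (edges (K1∨ G)))
    ≡⟨ sum-edges (K1∨ G) φ ⟩
  sum (map row (allFin (suc k)))
    ≡⟨ sum-allFin-suc k row ⟩
  row zero + sum (map (row ∘ suc) (allFin k))
    ≡⟨ cong₂ _+_ (trans (sum-allFin-suc k (term zero)) (sum-map-cong (allFin k) (λ v _ → +-identityʳ _)))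
                 (trans (sum-map-cong (allFin k) (λ a _ → sum-allFin-suc k (term (suc a))))
                        (sym (sum-edges G (λ (u , v) → φ (suc u , suc v))))) ⟩
  sum (map (λ v → φ (zero , suc v)) (allFin k)) + sum (map (λ (u , v) → φ (suc u , suc v)) (edges G)) ∎
  where
  open ≡-Reasoning
  term : Fin (suc k) → Fin (suc k) → ℕ
  term a b = 𝟙 ((toℕ a <ᵇ toℕ b) ∧ joinAdj G a b) * φ (a , b)
  row : Fin (suc k) → ℕ
  row a = sum (map (term a) (allFin (suc k)))

length-edges-join : {k : ℕ} (G : SimpleGraph k) → length (edges (K1∨ G)) ≡ k + length (edges G)
length-edges-join {k} G = trans (sym (ones (edges (K1∨ G))))
  (trans (sum-edges-join G (λ _ → 1)) (cong₂ _+_ (trans (ones (allFin k)) (length-allFin k)) (ones (edges G))))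
  where
  ones : {X : Set} (xs : List X) → sum (map (λ _ → 1) xs) ≡ length xs
  ones xs = trans (sum-map-const 1 xs) (*-identityʳ _)

module _ {N m : ℕ} {M : SimpleGraph N} (H : Cover M m) where

  missing+straight : ∀ a b → missing H (a , b) + straight H a b ≡ m
  missing+straight a b = trans (+-comm _ (straight H a b))
    (trans (count+count-not (λ j → hadj H (a , j) (b , j)) (allFin m)) (length-allFin m))

  crossedRow+straight : ∀ a b j →
    count (λ j′ → not (j == j′) ∧ hadj H (a , j) (b , j′)) (allFin m) + 𝟙 (hadj H (a , j) (b , j))
      ≡ count (λ j′ → hadj H (a , j) (b , j′)) (allFin m)
  crossedRow+straight a b j = begin
    count (λ j′ → not (j == j′) ∧ h j′) (allFin m) + 𝟙 (h j)
      ≡⟨ cong (count (λ j′ → not (j == j′) ∧ h j′) (allFin m) +_) diagonal ⟨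
    count (λ j′ → not (j == j′) ∧ h j′) (allFin m) + count (λ j′ → (j == j′) ∧ h j′) (allFin m)
      ≡⟨ +-comm (count (λ j′ → not (j == j′) ∧ h j′) (allFin m)) _ ⟩
    count (λ j′ → (j == j′) ∧ h j′) (allFin m) + count (λ j′ → not (j == j′) ∧ h j′) (allFin m)
      ≡⟨ split (allFin m) ⟩
    count h (allFin m) ∎
    where
    open ≡-Reasoning
    h : Fin m → Bool
    h j′ = hadj H (a , j) (b , j′)
    split : (xs : List (Fin m)) → count (λ j′ → (j == j′) ∧ h j′) xs + count (λ j′ → not (j == j′) ∧ h j′) xs ≡ count h xs
    split [] = refl
    split (y ∷ xs) rewrite count-∷ (λ j′ → (j == j′) ∧ h j′) y xs | count-∷ (λ j′ → not (j == j′) ∧ h j′) y xs | count-∷ h y xs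
      with j == y | h y
    ... | true  | true  = cong suc (split xs)
    ... | true  | false = split xs
    ... | false | true  = trans (+-suc _ _) (cong suc (split xs))
    ... | false | false = split xs
    j=j′⇒ : ∀ j′ → ((j == j′) ∧ h j′) ≡ (h j ∧ (j′ == j))
    j=j′⇒ j′ with j == j′ in j=j′ | j′ == j in j′=j
    ... | true  | true  with refl ← ==⇒≡ {u = j} j=j′ = sym (∧-identityʳ (h j))
    ... | true  | false with refl ← ==⇒≡ {u = j} j=j′ = ⊥-elim (true≢false (==-refl j) j′=j)
    ... | false | true  with refl ← ==⇒≡ {u = j′} j′=j = ⊥-elim (true≢false (==-refl j) j=j′)
    ... | false | false = sym (∧-zeroʳ (h j))
    diagonal : count (λ j′ → (j == j′) ∧ h j′) (allFin m) ≡ 𝟙 (h j)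
    diagonal = trans (count-cong (allFin m) (λ j′ _ → j=j′⇒ j′))
      (trans (count-∧-const (h j) (_== j) (allFin m)) (trans (cong (𝟙 (h j) *_) (count-==-allFin m j)) (*-identityʳ _)))

  crossed+straight : ∀ a b → crossCount H a b ≡ m → crossedCount H a b + straight H a b ≡ m
  crossed+straight a b perfect = begin
    crossedCount H a b + straight H a b
      ≡⟨ cong₂ _+_ (count-allPairs (λ (j , j′) → not (j == j′) ∧ hadj H (a , j) (b , j′))) (sym (sum-map-𝟙 (λ j → hadj H (a , j) (b , j)) (allFin m))) ⟩
    sum (map crossedRow (allFin m)) + sum (map (λ j → 𝟙 (hadj H (a , j) (b , j))) (allFin m))
      ≡⟨ sum-map-+ crossedRow _ (allFin m) ⟨
    sum (map (λ j → crossedRow j + 𝟙 (hadj H (a , j) (b , j))) (allFin m))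
      ≡⟨ sum-map-cong (allFin m) (λ j _ → crossedRow+straight a b j) ⟩
    sum (map (λ j → count (λ j′ → hadj H (a , j) (b , j′)) (allFin m)) (allFin m))
      ≡⟨ count-allPairs (λ (j , j′) → hadj H (a , j) (b , j′)) ⟨
    crossCount H a b
      ≡⟨ perfect ⟩
    m ∎
    where
    open ≡-Reasoning
    crossedRow : Fin m → ℕ
    crossedRow j = count (λ j′ → not (j == j′) ∧ hadj H (a , j) (b , j′)) (allFin m)

  missing≡crossed : ∀ a b → crossCount H a b ≡ m → missing H (a , b) ≡ crossedCount H a b
  missing≡crossed a b perfect = +-cancelʳ-≡ _ _ _ (trans (missing+straight a b) (sym (crossed+straight a b perfect)))

sum-combs-allFin-suc : (k j : ℕ) (ψ : List (Fin (suc k)) → ℕ) →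
  sum (map ψ (combs (suc j) (allFin (suc k)))) ≡
  sum (map (λ l → ψ (zero ∷ map suc l)) (combs j (allFin k))) + sum (map (λ l → ψ (map suc l)) (combs (suc j) (allFin k)))
sum-combs-allFin-suc k j ψ = begin
  sum (map ψ (combs (suc j) (allFin (suc k))))
    ≡⟨ cong (λ L → sum (map ψ (combs (suc j) L))) (allFin-suc k) ⟩
  sum (map ψ (map (zero ∷_) (combs j (map suc (allFin k))) ++ combs (suc j) (map suc (allFin k))))
    ≡⟨ sum-map-++ ψ (map (zero ∷_) (combs j (map suc (allFin k)))) _ ⟩
  sum (map ψ (map (zero ∷_) (combs j (map suc (allFin k))))) + sum (map ψ (combs (suc j) (map suc (allFin k))))
    ≡⟨ cong₂ _+_ (trans (sum-map-map ψ (zero ∷_) (combs j (map suc (allFin k)))) (shift (λ l → ψ (zero ∷ l)) j)) (shift ψ (suc j)) ⟩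
  sum (map (λ l → ψ (zero ∷ map suc l)) (combs j (allFin k))) + sum (map (λ l → ψ (map suc l)) (combs (suc j) (allFin k))) ∎
  where
  open ≡-Reasoning
  shift : (φ : List (Fin (suc k)) → ℕ) (i : ℕ) →
    sum (map φ (combs i (map suc (allFin k)))) ≡ sum (map (φ ∘ map suc) (combs i (allFin k)))
  shift φ i = trans (cong (λ L → sum (map φ L)) (combs-map suc i (allFin k))) (sum-map-map φ (map suc) (combs i (allFin k)))

onPair : {n : ℕ} → (Fin n → Fin n → ℕ) → List (Fin n) → ℕ
onPair ψ (b ∷ c ∷ []) = ψ b c
onPair ψ _            = 0

sum-combs2 : (n : ℕ) (ψ : Fin n → Fin n → ℕ) →
  sum (map (onPair ψ) (combs 2 (allFin n))) ≡ sum (map (λ a → sum (map (λ b → 𝟙 (toℕ a <ᵇ toℕ b) * ψ a b) (allFin n))) (allFin n))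
sum-combs2 zero    ψ = refl
sum-combs2 (suc n) ψ = begin
  sum (map (onPair ψ) (combs 2 (allFin (suc n))))
    ≡⟨ sum-combs-allFin-suc n 1 (onPair ψ) ⟩
  sum (map (λ l → onPair ψ (zero ∷ map suc l)) (combs 1 (allFin n))) + sum (map (λ l → onPair ψ (map suc l)) (combs 2 (allFin n)))
    ≡⟨ cong₂ _+_ (singletons (allFin n)) (trans (sum-map-cong (combs 2 (allFin n)) (λ l l∈ → onPair-suc l (∈-combs⇒length 2 (allFin n) l∈)))
                                                 (sum-combs2 n (λ a b → ψ (suc a) (suc b)))) ⟩
  sum (map (λ b → ψ zero (suc b)) (allFin n)) + sum (map (λ a → sum (map (λ b → 𝟙 (toℕ a <ᵇ toℕ b) * ψ (suc a) (suc b)) (allFin n))) (allFin n))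
    ≡⟨ cong₂ _+_ (trans (sum-map-cong (allFin n) (λ b _ → sym (+-identityʳ (ψ zero (suc b))))) (sym (sum-allFin-suc n (term zero))))
                 (sum-map-cong (allFin n) (λ a _ → sym (sum-allFin-suc n (term (suc a))))) ⟩
  sum (map (λ b → term zero b) (allFin (suc n))) + sum (map (λ a → sum (map (term (suc a)) (allFin (suc n)))) (allFin n))
    ≡⟨ sum-allFin-suc n (λ a → sum (map (term a) (allFin (suc n)))) ⟨
  sum (map (λ a → sum (map (term a) (allFin (suc n)))) (allFin (suc n))) ∎
  where
  open ≡-Reasoning
  term : Fin (suc n) → Fin (suc n) → ℕ
  term a b = 𝟙 (toℕ a <ᵇ toℕ b) * ψ a b
  singletons : (L : List (Fin n)) → sum (map (λ l → onPair ψ (zero ∷ map suc l)) (combs 1 L)) ≡ sum (map (λ b → ψ zero (suc b)) L)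
  singletons []      = refl
  singletons (b ∷ L) = cong (ψ zero (suc b) +_) (singletons L)
  onPair-suc : ∀ l → length l ≡ 2 → onPair ψ (map suc l) ≡ onPair (λ a b → ψ (suc a) (suc b)) l
  onPair-suc (a ∷ b ∷ []) _ = refl

sum-edges≡sum-combs2 : {n : ℕ} (Gr : SimpleGraph n) (φ : Fin n × Fin n → ℕ) →
  sum (map φ (edges Gr)) ≡ sum (map (onPair (λ a b → 𝟙 (adj Gr a b) * φ (a , b))) (combs 2 (allFin n)))
sum-edges≡sum-combs2 {n} Gr φ = trans (sum-edges Gr φ)
  (trans (sum-map-cong (allFin n) (λ a _ → sum-map-cong (allFin n) (λ b _ → split a b)))
         (sym (sum-combs2 n (λ a b → 𝟙 (adj Gr a b) * φ (a , b)))))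
  where
  split : ∀ a b → 𝟙 ((toℕ a <ᵇ toℕ b) ∧ adj Gr a b) * φ (a , b) ≡ 𝟙 (toℕ a <ᵇ toℕ b) * (𝟙 (adj Gr a b) * φ (a , b))
  split a b = trans (cong (_* φ (a , b)) (𝟙-∧ (toℕ a <ᵇ toℕ b) (adj Gr a b))) (*-assoc (𝟙 (toℕ a <ᵇ toℕ b)) (𝟙 (adj Gr a b)) (φ (a , b)))

isTriangle-map-suc : {k : ℕ} (G : SimpleGraph k) (l : List (Fin k)) → isTriangle (K1∨ G) (map suc l) ≡ isTriangle G l
isTriangle-map-suc G []                    = refl
isTriangle-map-suc G (a ∷ [])              = refl
isTriangle-map-suc G (a ∷ b ∷ [])          = refl
isTriangle-map-suc G (a ∷ b ∷ c ∷ [])      = refl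
isTriangle-map-suc G (a ∷ b ∷ c ∷ d ∷ l)   = refl

isTriangle-zero∷ : {k : ℕ} (G : SimpleGraph k) (l : List (Fin k)) → length l ≡ 2 →
  𝟙 (isTriangle (K1∨ G) (zero ∷ map suc l)) ≡ onPair (λ b c → 𝟙 (adj G b c)) l
isTriangle-zero∷ G (b ∷ c ∷ []) _ = cong 𝟙 (∧-identityʳ (adj G b c))

triangles-join : {k : ℕ} (G : SimpleGraph k) → triangles (K1∨ G) ≡ length (edges G) + triangles G
triangles-join {k} G = begin
  count (isTriangle (K1∨ G)) (combs 3 (allFin (suc k)))
    ≡⟨ sum-map-𝟙 (isTriangle (K1∨ G)) (combs 3 (allFin (suc k))) ⟨
  sum (map (λ T → 𝟙 (isTriangle (K1∨ G) T)) (combs 3 (allFin (suc k))))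
    ≡⟨ sum-combs-allFin-suc k 2 (λ T → 𝟙 (isTriangle (K1∨ G) T)) ⟩
  sum (map (λ l → 𝟙 (isTriangle (K1∨ G) (zero ∷ map suc l))) (combs 2 (allFin k))) + sum (map (λ l → 𝟙 (isTriangle (K1∨ G) (map suc l))) (combs 3 (allFin k)))
    ≡⟨ cong₂ _+_ (sum-map-cong (combs 2 (allFin k)) (λ l l∈ → isTriangle-zero∷ G l (∈-combs⇒length 2 (allFin k) l∈)))
                 (trans (sum-map-cong (combs 3 (allFin k)) (λ l _ → cong 𝟙 (isTriangle-map-suc G l))) (sum-map-𝟙 (isTriangle G) (combs 3 (allFin k)))) ⟩
  sum (map (onPair (λ b c → 𝟙 (adj G b c))) (combs 2 (allFin k))) + triangles G
    ≡⟨ cong (_+ triangles G) (trans (sum-map-cong (combs 2 (allFin k)) (λ l l∈ → onPair-1 l (∈-combs⇒length 2 (allFin k) l∈)))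
                                    (sym (sum-edges≡sum-combs2 G (λ _ → 1)))) ⟩
  sum (map (λ _ → 1) (edges G)) + triangles G
    ≡⟨ cong (_+ triangles G) (trans (sum-map-const 1 (edges G)) (*-identityʳ _)) ⟩
  length (edges G) + triangles G ∎
  where
  open ≡-Reasoning
  onPair-1 : ∀ l → length l ≡ 2 → onPair (λ b c → 𝟙 (adj G b c)) l ≡ onPair (λ a b → 𝟙 (adj G a b) * 1) l
  onPair-1 (b ∷ c ∷ []) _ = sym (*-identityʳ _)

^-∸-suc : (m : ℕ) {n d : ℕ} → suc d ≤ n → m ^ (n ∸ d) ≡ m * m ^ (n ∸ suc d)
^-∸-suc m {suc n} {zero}  _         = refl
^-∸-suc m {suc n} {suc d} (s≤s d<n) = ^-∸-suc m d<n

module TriangleSum {k m : ℕ} (G : SimpleGraph k) (H : Cover (K1∨ G) m)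
                   (perfect : ∀ u v → adj (K1∨ G) u v ≡ true → crossCount H u v ≡ m) (k≥2 : 2 ≤ k) where

  N = suc k
  M = K1∨ G

  crossedG : ℕ
  crossedG = sum (map (λ (u , v) → crossedCount H (suc u) (suc v)) (edges G))

  m^[N∸2]≡ : m ^ (N ∸ 2) ≡ m * m ^ (N ∸ 3)
  m^[N∸2]≡ = ^-∸-suc m (s≤s k≥2)

  -- The bound on |S_F| for the triangle F with vertex set T; through w it is exact.
  triangleWeight : List (Fin N) → ℕ
  triangleWeight (zero ∷ p ∷ q ∷ []) = straight H p q * m ^ (N ∸ 3)
  triangleWeight _                   = m ^ (N ∸ 2)

  weighted : List (Fin N) → ℕ
  weighted T = 𝟙 (isTriangle M T) * triangleWeight T

  through-w : sum (map (λ l → weighted (zero ∷ map suc l)) (combs 2 (allFin k)))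
              ≡ sum (map (λ (u , v) → straight H (suc u) (suc v) * m ^ (N ∸ 3)) (edges G))
  through-w = trans (sum-map-cong (combs 2 (allFin k)) (λ l l∈ → pair l (∈-combs⇒length 2 (allFin k) l∈)))
                    (sym (sum-edges≡sum-combs2 G (λ (u , v) → straight H (suc u) (suc v) * m ^ (N ∸ 3))))
    where
    pair : ∀ l → length l ≡ 2 → weighted (zero ∷ map suc l)
                                ≡ onPair (λ b c → 𝟙 (adj G b c) * (straight H (suc b) (suc c) * m ^ (N ∸ 3))) l
    pair (b ∷ c ∷ []) _ = cong (λ z → 𝟙 z * (straight H (suc b) (suc c) * m ^ (N ∸ 3))) (∧-identityʳ (adj G b c))

  avoiding-w : sum (map (λ l → weighted (map suc l)) (combs 3 (allFin k))) ≡ triangles G * m ^ (N ∸ 2)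
  avoiding-w = trans (sum-map-cong (combs 3 (allFin k)) (λ l l∈ → triple l (∈-combs⇒length 3 (allFin k) l∈)))
                     (sum-map-𝟙* (isTriangle G) (m ^ (N ∸ 2)) (combs 3 (allFin k)))
    where
    triple : ∀ l → length l ≡ 3 → weighted (map suc l) ≡ 𝟙 (isTriangle G l) * m ^ (N ∸ 2)
    triple (a ∷ b ∷ c ∷ []) _ = refl

  straight+crossed : sum (map (λ (u , v) → straight H (suc u) (suc v) * m ^ (N ∸ 3)) (edges G)) + crossedG * m ^ (N ∸ 3)
                     ≡ length (edges G) * m ^ (N ∸ 2)
  straight+crossed = begin
    sum (map (λ (u , v) → straight H (suc u) (suc v) * m ^ (N ∸ 3)) (edges G)) + crossedG * m ^ (N ∸ 3)
      ≡⟨ cong₂ _+_ (sum-map-*ʳ _ (λ (u , v) → straight H (suc u) (suc v)) (edges G)) refl ⟩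
    sum (map (λ (u , v) → straight H (suc u) (suc v)) (edges G)) * m ^ (N ∸ 3) + crossedG * m ^ (N ∸ 3)
      ≡⟨ *-distribʳ-+ (m ^ (N ∸ 3)) (sum (map (λ (u , v) → straight H (suc u) (suc v)) (edges G))) crossedG ⟨
    (sum (map (λ (u , v) → straight H (suc u) (suc v)) (edges G)) + crossedG) * m ^ (N ∸ 3)
      ≡⟨ cong (_* m ^ (N ∸ 3)) (sum-map-+ (λ (u , v) → straight H (suc u) (suc v)) (λ (u , v) → crossedCount H (suc u) (suc v)) (edges G)) ⟨
    sum (map (λ (u , v) → straight H (suc u) (suc v) + crossedCount H (suc u) (suc v)) (edges G)) * m ^ (N ∸ 3)
      ≡⟨ cong (_* m ^ (N ∸ 3)) (trans (sum-map-cong (edges G) (λ (u , v) uv∈ → m-per-edge u v uv∈)) (sum-map-const m (edges G))) ⟩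
    length (edges G) * m * m ^ (N ∸ 3)
      ≡⟨ trans (*-assoc (length (edges G)) m _) (cong (length (edges G) *_) (sym m^[N∸2]≡)) ⟩
    length (edges G) * m ^ (N ∸ 2) ∎
    where
    open ≡-Reasoning
    m-per-edge : ∀ u v → (u , v) ∈ edges G → straight H (suc u) (suc v) + crossedCount H (suc u) (suc v) ≡ m
    m-per-edge u v uv∈ = trans (+-comm (straight H (suc u) (suc v)) _) (crossed+straight H (suc u) (suc v) (perfect (suc u) (suc v) (proj₂ (∈-edges⁻ G uv∈))))

  sum-weighted : sum (map weighted (combs 3 (allFin N))) + crossedG * m ^ (N ∸ 3) ≡ triangles M * m ^ (N ∸ 2)
  sum-weighted = begin
    sum (map weighted (combs 3 (allFin N))) + crossedG * m ^ (N ∸ 3)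
      ≡⟨ cong (_+ crossedG * m ^ (N ∸ 3)) (sum-combs-allFin-suc k 2 weighted) ⟩
    (sum (map (λ l → weighted (zero ∷ map suc l)) (combs 2 (allFin k))) + sum (map (λ l → weighted (map suc l)) (combs 3 (allFin k))))
      + crossedG * m ^ (N ∸ 3)
      ≡⟨ cong (λ z → z + crossedG * m ^ (N ∸ 3)) (cong₂ _+_ through-w avoiding-w) ⟩
    (S + triangles G * m ^ (N ∸ 2)) + crossedG * m ^ (N ∸ 3)
      ≡⟨ trans (+-assoc S T₀ X₀) (trans (cong (S +_) (+-comm T₀ X₀)) (sym (+-assoc S X₀ T₀))) ⟩
    (S + crossedG * m ^ (N ∸ 3)) + triangles G * m ^ (N ∸ 2)
      ≡⟨ cong (_+ triangles G * m ^ (N ∸ 2)) straight+crossed ⟩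
    length (edges G) * m ^ (N ∸ 2) + triangles G * m ^ (N ∸ 2)
      ≡⟨ *-distribʳ-+ (m ^ (N ∸ 2)) (length (edges G)) _ ⟨
    (length (edges G) + triangles G) * m ^ (N ∸ 2)
      ≡⟨ cong (_* m ^ (N ∸ 2)) (triangles-join G) ⟨
    triangles M * m ^ (N ∸ 2) ∎
    where
    open ≡-Reasoning
    S = sum (map (λ (u , v) → straight H (suc u) (suc v) * m ^ (N ∸ 3)) (edges G))
    T₀ = triangles G * m ^ (N ∸ 2)
    X₀ = crossedG * m ^ (N ∸ 3)

^-monoʳ-≤⁺ : (m : ℕ) {c d : ℕ} → 1 ≤ c → c ≤ d → m ^ c ≤ m ^ d
^-monoʳ-≤⁺ zero    {suc c} _ _   = z≤n
^-monoʳ-≤⁺ (suc m)         _ c≤d = ^-monoʳ-≤ (suc m) c≤d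

vertices : {N : ℕ} → List (Fin N × Fin N) → List (Fin N)
vertices ((a , p) ∷ _ ∷ (_ , q) ∷ []) = a ∷ p ∷ q ∷ []
vertices _                            = []

edgesOf : {N : ℕ} → List (Fin N) → List (Fin N × Fin N)
edgesOf (a ∷ p ∷ q ∷ []) = (a , p) ∷ (a , q) ∷ (p , q) ∷ []
edgesOf _                = []

module Bounds {k m : ℕ} (G : SimpleGraph k) (H : Cover (K1∨ G) m)
              (perfect : ∀ u v → adj (K1∨ G) u v ≡ true → crossCount H u v ≡ m)
              (w-straight : ∀ (v : Fin k) (j : Fin m) → hadj H (zero , j) (suc v , j) ≡ true)
              (k≥3 : 3 ≤ k) where

  open TriangleSum G H perfect (≤-trans (n≤1+n 2) k≥3) public

  E = edges M

  rank3 : List (Fin N × Fin N) → Bool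
  rank3 F = components F ≡ᵇ (N ∸ 3)

  missing-E : sum (map (missing H) E) ≡ crossedG
  missing-E = trans (sum-edges-join G (missing H)) (cong₂ _+_ w-edges G-edges)
    where
    w-edges : sum (map (λ v → missing H (zero , suc v)) (allFin k)) ≡ 0
    w-edges = trans (sum-map-cong (allFin k) (λ v _ → count-none (allFin m) (λ j _ → cong not (w-straight v j))))
                    (trans (sum-map-const 0 (allFin k)) (*-zeroʳ (length (allFin k))))
    G-edges : sum (map (λ (u , v) → missing H (suc u , suc v)) (edges G)) ≡ crossedG
    G-edges = sum-map-cong (edges G) (λ (u , v) uv∈ → missing≡crossed H (suc u) (suc v) (perfect (suc u) (suc v) (proj₂ (∈-edges⁻ G uv∈))))

  module OfSize (i : ℕ) (F : List (Fin N × Fin N)) (F∈ : F ∈ combs i E) where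
    open Connectivity F
    open Rank F
    open Transversals H F using (c; inSF; inSF⇒edge; sizeS≤m^c; sizeS≤-at-root; m^c≤sizeS+missing)

    F⊆E : ∀ {e} → e ∈ F → e ∈ E
    F⊆E = ∈-combs⇒⊆ i E F∈

    F⊆M : ∀ {a b} → (a , b) ∈ F → adj M a b ≡ true
    F⊆M ab∈ = proj₂ (∈-edges⁻ M (F⊆E ab∈))

    F-< : ∀ {a b} → (a , b) ∈ F → a <ᶠ b
    F-< ab∈ = proj₁ (∈-edges⁻ M (F⊆E ab∈))

    F-sorted : AllPairs _<ₑ_ F
    F-sorted = ∈-combs⇒sorted i E (edges-sorted M) F∈

    F! : AllPairs (λ x y → ¬ (x ≡ y)) F
    F! = sorted⇒distinct <ₑ-irrefl F-sorted

    length-F : length F ≡ i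
    length-F = ∈-combs⇒length i E F∈

    c≥1 : 1 ≤ c
    c≥1 = ∃⇒count-pos isRoot (∈-allFin zero) (cong not (any-false⁺ _ (allFin N) (λ _ → refl)))

    sizeS≤ : sizeS H F ≤ m ^ c
    sizeS≤ = sizeS≤m^c F⊆M

    i>⇒r> : ∀ j → suc j C 2 < i → j < r
    i>⇒r> j long = long⇒r> F-< F! j (subst (suc j C 2 <_) (sym length-F) long)

    c≤N∸4 : 7 ≤ i → c ≤ N ∸ 4
    c≤N∸4 7≤i = components≤N∸ (i>⇒r> 3 7≤i)

    c≤N∸3 : 4 ≤ i → c ≤ N ∸ 3
    c≤N∸3 4≤i = components≤N∸ (i>⇒r> 2 4≤i)

    rank3⇒lower : rank3 F ≡ true → m ^ (N ∸ 3) ≤ sizeS H F + crossedG * m ^ (N ∸ 4)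
    rank3⇒lower rk = begin
      m ^ (N ∸ 3)                                       ≡⟨ cong (m ^_) c≡ ⟨
      m ^ c                                             ≤⟨ m^c≤sizeS+missing ⟩
      sizeS H F + sum (map (missing H) F) * m ^ (c ∸ 1) ≤⟨ +-monoʳ-≤ (sizeS H F) (*-mono-≤ missing-F (≤-reflexive (cong (λ z → m ^ (z ∸ 1)) c≡))) ⟩
      sizeS H F + crossedG * m ^ (N ∸ 3 ∸ 1)            ≡⟨ cong (λ z → sizeS H F + crossedG * m ^ z) (∸-+-assoc N 3 1) ⟩
      sizeS H F + crossedG * m ^ (N ∸ 4)                ∎
      where
      open ≤-Reasoning
      c≡ : c ≡ N ∸ 3
      c≡ = ≡ᵇ-true⇒≡ {c} {N ∸ 3} rk
      missing-F : sum (map (missing H) F) ≤ crossedG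
      missing-F = ≤-trans (sum-map-≤-injection F E id (missing H) (missing H) F! (λ _ → F⊆E) (λ _ _ _ _ e → e) (λ _ _ → ≤-refl))
                          (≤-reflexive missing-E)

    bound-rank3 : 𝟙 (rank3 F) * m ^ (N ∸ 3) ≤ sizeS H F + 𝟙 (rank3 F) * (crossedG * m ^ (N ∸ 4))
    bound-rank3 with rank3 F in rk
    ... | false = z≤n
    ... | true  = subst₂ _≤_ (sym (+-identityʳ _)) (cong (sizeS H F +_) (sym (+-identityʳ _))) (rank3⇒lower rk)

    bound-split : 4 ≤ i → sizeS H F ≤ 𝟙 (rank3 F) * m ^ (N ∸ 3) + 𝟙 (not (rank3 F)) * m ^ (N ∸ 4)
    bound-split 4≤i with rank3 F in rk
    ... | true  = ≤-trans sizeS≤ (≤-reflexive (trans (cong (m ^_) (≡ᵇ-true⇒≡ {c} {N ∸ 3} rk)) (trans (sym (+-identityʳ (m ^ (N ∸ 3)))) (sym (+-identityʳ (m ^ (N ∸ 3) + 0))))))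
    ... | false = ≤-trans sizeS≤ (≤-trans (^-monoʳ-≤⁺ m c≥1 c≤N∸4′) (≤-reflexive (sym (+-identityʳ _))))
      where
      c≤N∸4′ : c ≤ N ∸ 4
      c≤N∸4′ with m≤n⇒m<n∨m≡n (c≤N∸3 4≤i)
      ... | inj₂ c≡ = ⊥-elim (≡ᵇ-false⇒≢ {c} {N ∸ 3} rk c≡)
      ... | inj₁ c< = ≤-pred (subst (c <_) (N∸3≡ k≥3) c<)
        where
        N∸3≡ : 3 ≤ k → N ∸ 3 ≡ suc (N ∸ 4)
        N∸3≡ (s≤s (s≤s (s≤s _))) = refl

    -- A 3-subset of rank two is a triangle; it is charged to its vertex triple.
    module NotRank3 (i≡3 : i ≡ 3) (¬rank3 : rank3 F ≡ false) where

      length≡3 : length F ≡ 3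
      length≡3 = trans length-F i≡3

      r≡2 : r ≡ 2
      r≡2 with m≤n⇒m<n∨m≡n (i>⇒r> 1 (subst (1 <_) (sym i≡3) (s≤s (s≤s z≤n))))
      ... | inj₂ 2≡r = sym 2≡r
      ... | inj₁ 2<r with m≤n⇒m<n∨m≡n 2<r
      ...   | inj₂ 3≡r = ⊥-elim (≡ᵇ-false⇒≢ {c} {N ∸ 3} ¬rank3 (trans components≡N∸r (cong (N ∸_) (sym 3≡r))))
      ...   | inj₁ 3<r = ⊥-elim (<⇒≱ 3<r (subst (r ≤_) length≡3 r≤length))

      triangle : Σ (Fin N) λ a → Σ (Fin N) λ p → Σ (Fin N) λ q → TriangleShape.Triangle M F F⊆E F-sorted a p q
      triangle = TriangleShape.length3⇒triangle M F F⊆E F-sorted length≡3 r≡2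

      F≡edgesOf-vertices : F ≡ edgesOf (vertices F)
      F≡edgesOf-vertices with triangle
      ... | a , p , q , _ , _ , F≡ = trans F≡ (cong edgesOf (sym (cong vertices F≡)))

      vertices∈combs : vertices F ∈ combs 3 (allFin N)
      vertices∈combs with triangle
      ... | a , p , q , a<p , p<q , F≡ = subst (_∈ combs 3 (allFin N)) (sym (cong vertices F≡))
        (sorted⇒∈-combs-allFin N (a ∷ p ∷ q ∷ []) ((a<p ∷ <-trans a<p p<q ∷ []) ∷ (p<q ∷ []) ∷ [] ∷ []))

      c≡N∸2 : c ≡ N ∸ 2
      c≡N∸2 = trans components≡N∸r (cong (N ∸_) r≡2)

      sizeS≤weighted : sizeS H F ≤ weighted (vertices F)
      sizeS≤weighted with triangle
      ... | a , p , q , a<p , p<q , F≡ =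
        subst (λ T → sizeS H F ≤ weighted T) (sym (cong vertices F≡))
          (subst (λ b → sizeS H F ≤ 𝟙 b * triangleWeight (a ∷ p ∷ q ∷ [])) (sym isTri)
            (≤-trans (by-apex a p q a<p ap∈ aq∈ pq∈) (≤-reflexive (sym (+-identityʳ _)))))
        where
        ap∈ : (a , p) ∈ F
        ap∈ = subst ((a , p) ∈_) (sym F≡) (here refl)
        aq∈ : (a , q) ∈ F
        aq∈ = subst ((a , q) ∈_) (sym F≡) (there (here refl))
        pq∈ : (p , q) ∈ F
        pq∈ = subst ((p , q) ∈_) (sym F≡) (there (there (here refl)))
        isTri : isTriangle M (a ∷ p ∷ q ∷ []) ≡ true
        isTri = ∧-true⁺ (F⊆M ap∈) (∧-true⁺ (F⊆M pq∈) (F⊆M aq∈))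
        -- the matchings at w are the identity, so f is constant on the triangle
        by-apex : ∀ a p q → a <ᶠ p → (a , p) ∈ F → (a , q) ∈ F → (p , q) ∈ F → sizeS H F ≤ triangleWeight (a ∷ p ∷ q ∷ [])
        by-apex (suc _) p q _ _ _ _ = ≤-trans sizeS≤ (≤-reflexive (cong (m ^_) c≡N∸2))
        by-apex zero (suc p) (suc q) _ ap∈ aq∈ pq∈ = ≤-trans
          (sizeS≤-at-root F⊆M zero (λ j → hadj H (suc p , j) (suc q , j)) root-zero straight-at-w)
          (≤-reflexive (cong (λ z → straight H (suc p) (suc q) * m ^ z) (trans (cong (_∸ 1) c≡N∸2) (∸-+-assoc N 2 1))))
          where
          root-zero : isRoot zero ≡ true
          root-zero = cong not (any-false⁺ _ (allFin N) (λ _ → refl))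
          follows-w : ∀ f → inSF f ≡ true → ∀ {v} → (zero , suc v) ∈ F → f (suc v) ≡ f zero
          follows-w f Sf zv∈ = matching H zero _ (f zero) _ (f zero) (F⊆M zv∈) (inSF⇒edge f Sf zv∈) (w-straight _ (f zero))
          straight-at-w : ∀ f → inSF f ≡ true → hadj H (suc p , f zero) (suc q , f zero) ≡ true
          straight-at-w f Sf = subst₂ (λ u v → hadj H (suc p , u) (suc q , v) ≡ true) (follows-w f Sf ap∈) (follows-w f Sf aq∈)
                                 (inSF⇒edge f Sf pq∈)
        by-apex zero zero    _       ()
        by-apex zero (suc p) zero    _  _ aq∈ _ = ⊥-elim (<-irrefl refl (F-< aq∈))

  length-E : length E ≡ k + length (edges G)
  length-E = length-edges-join G

  sum-rank3-split : (f g : List (Fin N × Fin N) → ℕ) (Fs : List (List (Fin N × Fin N))) →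
    sum (map (λ F → 𝟙 (rank3 F) * f F + 𝟙 (not (rank3 F)) * g F) Fs)
      ≡ sum (map (λ F → 𝟙 (rank3 F) * f F) Fs) + sum (map (λ F → 𝟙 (not (rank3 F)) * g F) Fs)
  sum-rank3-split f g = sum-map-+ (λ F → 𝟙 (rank3 F) * f F) (λ F → 𝟙 (not (rank3 F)) * g F)

  sumS≤-large : ∀ i → 7 ≤ i → sumS H i ≤ ((k + length (edges G)) C i) * m ^ (N ∸ 4)
  sumS≤-large i 7≤i = begin
    sum (map (sizeS H) (combs i E))     ≤⟨ sum-map-mono (combs i E) (λ F F∈ → let open OfSize i F F∈ in
                                             ≤-trans sizeS≤ (^-monoʳ-≤⁺ m c≥1 (c≤N∸4 7≤i))) ⟩
    sum (map (λ _ → m ^ (N ∸ 4)) (combs i E)) ≡⟨ sum-map-const (m ^ (N ∸ 4)) (combs i E) ⟩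
    length (combs i E) * m ^ (N ∸ 4)    ≡⟨ cong (_* m ^ (N ∸ 4)) (trans (length-combs i E) (cong (_C i) length-E)) ⟩
    ((k + length (edges G)) C i) * m ^ (N ∸ 4) ∎
    where open ≤-Reasoning

  sumS≥-rank3 : ∀ i → countP M i (N ∸ 3) * m ^ (N ∸ 3) ≤ sumS H i + countP M i (N ∸ 3) * crossedG * m ^ (N ∸ 4)
  sumS≥-rank3 i = begin
    countP M i (N ∸ 3) * m ^ (N ∸ 3)                          ≡⟨ sum-map-𝟙* rank3 (m ^ (N ∸ 3)) (combs i E) ⟨
    sum (map (λ F → 𝟙 (rank3 F) * m ^ (N ∸ 3)) (combs i E))  ≤⟨ sum-map-mono (combs i E) (λ F F∈ → OfSize.bound-rank3 i F F∈) ⟩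
    sum (map (λ F → sizeS H F + 𝟙 (rank3 F) * (crossedG * m ^ (N ∸ 4))) (combs i E))
                                                              ≡⟨ sum-map-+ (sizeS H) (λ F → 𝟙 (rank3 F) * (crossedG * m ^ (N ∸ 4))) (combs i E) ⟩
    sumS H i + sum (map (λ F → 𝟙 (rank3 F) * (crossedG * m ^ (N ∸ 4))) (combs i E))
                                                              ≡⟨ cong (sumS H i +_) (trans (sum-map-𝟙* rank3 _ (combs i E)) (sym (*-assoc (countP M i (N ∸ 3)) crossedG (m ^ (N ∸ 4))))) ⟩
    sumS H i + countP M i (N ∸ 3) * crossedG * m ^ (N ∸ 4)    ∎
    where open ≤-Reasoning

  sumS5≤ : sumS H 5 ≤ countP M 5 (N ∸ 3) * m ^ (N ∸ 3) + count (not ∘ rank3) (combs 5 E) * m ^ (N ∸ 4)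
  sumS5≤ = begin
    sum (map (sizeS H) (combs 5 E))
      ≤⟨ sum-map-mono (combs 5 E) (λ F F∈ → OfSize.bound-split 5 F F∈ (s≤s (s≤s (s≤s (s≤s z≤n))))) ⟩
    sum (map (λ F → 𝟙 (rank3 F) * m ^ (N ∸ 3) + 𝟙 (not (rank3 F)) * m ^ (N ∸ 4)) (combs 5 E))
      ≡⟨ sum-rank3-split (λ _ → m ^ (N ∸ 3)) (λ _ → m ^ (N ∸ 4)) (combs 5 E) ⟩
    sum (map (λ F → 𝟙 (rank3 F) * m ^ (N ∸ 3)) (combs 5 E)) + sum (map (λ F → 𝟙 (not (rank3 F)) * m ^ (N ∸ 4)) (combs 5 E))
      ≡⟨ cong₂ _+_ (sum-map-𝟙* rank3 _ (combs 5 E)) (sum-map-𝟙* (not ∘ rank3) _ (combs 5 E)) ⟩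
    countP M 5 (N ∸ 3) * m ^ (N ∸ 3) + count (not ∘ rank3) (combs 5 E) * m ^ (N ∸ 4) ∎
    where open ≤-Reasoning

  count-rank3+not : ∀ i → countP M i (N ∸ 3) + count (not ∘ rank3) (combs i E) ≡ (k + length (edges G)) C i
  count-rank3+not i = trans (count+count-not rank3 (combs i E)) (trans (length-combs i E) (cong (_C i) length-E))

  nonRank3 : List (List (Fin N × Fin N))
  nonRank3 = filterᵇ (not ∘ rank3) (combs 3 E)

  sumS3≤ : sumS H 3 ≤ countP M 3 (N ∸ 3) * m ^ (N ∸ 3) + sum (map (sizeS H) nonRank3)
  sumS3≤ = begin
    sum (map (sizeS H) C₃)
      ≤⟨ sum-map-mono C₃ per-F ⟩
    sum (map (λ F → 𝟙 (rank3 F) * m ^ (N ∸ 3) + 𝟙 (not (rank3 F)) * sizeS H F) C₃)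
      ≡⟨ sum-rank3-split (λ _ → m ^ (N ∸ 3)) (sizeS H) C₃ ⟩
    sum (map (λ F → 𝟙 (rank3 F) * m ^ (N ∸ 3)) C₃) + sum (map (λ F → 𝟙 (not (rank3 F)) * sizeS H F) C₃)
      ≡⟨ cong₂ _+_ (sum-map-𝟙* rank3 _ C₃) (sym (sum-map-filterᵇ (not ∘ rank3) (sizeS H) C₃)) ⟩
    countP M 3 (N ∸ 3) * m ^ (N ∸ 3) + sum (map (sizeS H) nonRank3) ∎
    where
    open ≤-Reasoning
    C₃ = combs 3 E
    per-F : ∀ F → F ∈ C₃ → sizeS H F ≤ 𝟙 (rank3 F) * m ^ (N ∸ 3) + 𝟙 (not (rank3 F)) * sizeS H F
    per-F F F∈ with rank3 F in rk
    ... | true  = ≤-trans (OfSize.sizeS≤ 3 F F∈)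
                    (≤-reflexive (trans (cong (m ^_) (≡ᵇ-true⇒≡ {components F} {N ∸ 3} rk))
                                        (trans (sym (+-identityʳ (m ^ (N ∸ 3)))) (sym (+-identityʳ (m ^ (N ∸ 3) + 0))))))
    ... | false = ≤-reflexive (sym (+-identityʳ (sizeS H F)))

  sum-nonRank3≤ : sum (map (sizeS H) nonRank3) ≤ sum (map weighted (combs 3 (allFin N)))
  sum-nonRank3≤ = sum-map-≤-injection nonRank3 (combs 3 (allFin N)) vertices (sizeS H) weighted
    (filterᵇ-sorted (not ∘ rank3) (combs-distinct <ₑ-irrefl 3 E (edges-sorted M)))
    (λ F F∈ → T.vertices∈combs F∈)
    (λ F F′ F∈ F′∈ same → trans (T.F≡edgesOf-vertices F∈) (trans (cong edgesOf same) (sym (T.F≡edgesOf-vertices F′∈))))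
    (λ F F∈ → T.sizeS≤weighted F∈)
    where
    ∈nonRank3 : ∀ {F} → F ∈ nonRank3 → F ∈ combs 3 E × rank3 F ≡ false
    ∈nonRank3 F∈ with ∈-filterᵇ⁻ (not ∘ rank3) {combs 3 E} F∈
    ... | F∈C₃ , nr = F∈C₃ , not-true⁻ nr
    module T {F} (F∈ : F ∈ nonRank3) = OfSize.NotRank3 3 F (proj₁ (∈nonRank3 F∈)) refl (proj₂ (∈nonRank3 F∈))

  sumS3+crossed≤ : sumS H 3 + crossedG * m ^ (N ∸ 3) ≤ countP M 3 (N ∸ 3) * m ^ (N ∸ 3) + triangles M * m ^ (N ∸ 2)
  sumS3+crossed≤ = begin
    sumS H 3 + crossedG * m ^ (N ∸ 3)
      ≤⟨ +-monoˡ-≤ (crossedG * m ^ (N ∸ 3)) (≤-trans sumS3≤ (+-monoʳ-≤ P₃ sum-nonRank3≤)) ⟩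
    (P₃ + sum (map weighted (combs 3 (allFin N)))) + crossedG * m ^ (N ∸ 3)
      ≡⟨ +-assoc P₃ (sum (map weighted (combs 3 (allFin N)))) (crossedG * m ^ (N ∸ 3)) ⟩
    P₃ + (sum (map weighted (combs 3 (allFin N))) + crossedG * m ^ (N ∸ 3))
      ≡⟨ cong (P₃ +_) sum-weighted ⟩
    P₃ + triangles M * m ^ (N ∸ 2) ∎
    where
    open ≤-Reasoning
    P₃ = countP M 3 (N ∸ 3) * m ^ (N ∸ 3)

open import Data.Integer as ℤ using (ℤ; +_)
import Data.Integer.Properties as ℤ

pos-≤-sub-add : ∀ {S a b c : ℕ} → S + a ≤ b + c → + S ℤ.≤ (+ b ℤ.- + a) ℤ.+ + c
pos-≤-sub-add {S} {a} {b} {c} h = begin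
  + S                          ≡⟨ ℤ.+-identityʳ (+ S) ⟨
  + S ℤ.+ ℤ.0ℤ                 ≡⟨ cong (λ w → + S ℤ.+ w) (ℤ.+-inverseʳ (+ a)) ⟨
  + S ℤ.+ (+ a ℤ.- + a)        ≡⟨ ℤ.+-assoc (+ S) (+ a) (ℤ.- + a) ⟨
  (+ S ℤ.+ + a) ℤ.- + a        ≡⟨ cong (ℤ._- + a) (ℤ.pos-+ S a) ⟨
  + (S + a) ℤ.- + a            ≤⟨ ℤ.+-monoˡ-≤ (ℤ.- + a) (ℤ.+≤+ h) ⟩
  + (b + c) ℤ.- + a            ≡⟨ cong (ℤ._- + a) (ℤ.pos-+ b c) ⟩
  (+ b ℤ.+ + c) ℤ.- + a        ≡⟨ ℤ.+-assoc (+ b) (+ c) (ℤ.- + a) ⟩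
  + b ℤ.+ (+ c ℤ.- + a)        ≡⟨ cong (λ w → + b ℤ.+ w) (ℤ.+-comm (+ c) (ℤ.- + a)) ⟩
  + b ℤ.+ (ℤ.- + a ℤ.+ + c)    ≡⟨ ℤ.+-assoc (+ b) (ℤ.- + a) (+ c) ⟨
  (+ b ℤ.- + a) ℤ.+ + c        ∎
  where open ℤ.≤-Reasoning

pos-sub-≤ : ∀ {S a b : ℕ} → a ≤ S + b → + a ℤ.- + b ℤ.≤ + S
pos-sub-≤ {S} {a} {b} h = begin
  + a ℤ.- + b              ≤⟨ ℤ.+-monoˡ-≤ (ℤ.- + b) (ℤ.+≤+ h) ⟩
  + (S + b) ℤ.- + b        ≡⟨ cong (ℤ._- + b) (ℤ.pos-+ S b) ⟩
  (+ S ℤ.+ + b) ℤ.- + b    ≡⟨ ℤ.+-assoc (+ S) (+ b) (ℤ.- + b) ⟩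
  + S ℤ.+ (+ b ℤ.- + b)    ≡⟨ cong (λ w → + S ℤ.+ w) (ℤ.+-inverseʳ (+ b)) ⟩
  + S ℤ.+ ℤ.0ℤ             ≡⟨ ℤ.+-identityʳ (+ S) ⟩
  + S                      ∎
  where open ℤ.≤-Reasoning

pos-≤-add-sub-mul : ∀ {S A P Q L B : ℕ} → S ≤ A + Q * B → P + Q ≡ L → + S ℤ.≤ + A ℤ.+ (+ L ℤ.- + P) ℤ.* + B
pos-≤-add-sub-mul {S} {A} {P} {Q} {L} {B} h refl = begin
  + S                                ≤⟨ ℤ.+≤+ h ⟩
  + (A + Q * B)                      ≡⟨ trans (ℤ.pos-+ A (Q * B)) (cong (λ w → + A ℤ.+ w) (ℤ.pos-* Q B)) ⟩
  + A ℤ.+ + Q ℤ.* + B                ≡⟨ cong (λ z → + A ℤ.+ z ℤ.* + B) Q≡ ⟩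
  + A ℤ.+ (+ (P + Q) ℤ.- + P) ℤ.* + B ∎
  where
  open ℤ.≤-Reasoning
  Q≡ : + Q ≡ + (P + Q) ℤ.- + P
  Q≡ = sym (trans (cong (ℤ._- + P) (trans (ℤ.pos-+ P Q) (ℤ.+-comm (+ P) (+ Q))))
         (trans (ℤ.+-assoc (+ Q) (+ P) (ℤ.- + P)) (trans (cong (λ w → + Q ℤ.+ w) (ℤ.+-inverseʳ (+ P))) (ℤ.+-identityʳ (+ Q)))))

lemma14 : (k : ℕ) (G : SimpleGraph k) (m : ℕ) (H : Cover (K1∨ G) m) →
    let n = suc k
        M = K1∨ G
        s = length (edges G)
        x = sum (map (λ { (u , v) → crossedCount H (suc u) (suc v) }) (edges G))
        t = triangles M
        P = λ i → countP M i (n ∸ 3)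
        e = n + s ∸ 1
    in 4 ≤ n → 3 ≤ s →
       (∀ u v → adj M u v ≡ true → crossCount H u v ≡ m) →
       (∀ (v : Fin k) (j : Fin m) → hadj H (zero , j) (suc v , j) ≡ true) →
       (+ sumS H 3 ℤ.≤ (+ (t * m ^ (n ∸ 2)) ℤ.- + (x * m ^ (n ∸ 3))) ℤ.+ + (P 3 * m ^ (n ∸ 3)))
       × (+ sumS H 4 ℤ.≥ + (P 4 * m ^ (n ∸ 3)) ℤ.- + (2 * P 4 * x * m ^ (n ∸ 4)))
       × (+ sumS H 5 ℤ.≤ + (P 5 * m ^ (n ∸ 3)) ℤ.+ (+ (e C 5) ℤ.- + P 5) ℤ.* + (m ^ (n ∸ 4)))
       × (+ sumS H 6 ℤ.≥ + (P 6 * m ^ (n ∸ 3)) ℤ.- + (2 * P 6 * x * m ^ (n ∸ 4)))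
       × (∀ i → 7 ≤ i → sumS H i ≤ (e C i) * m ^ (n ∸ 4))
lemma14 k G m H (s≤s k≥3) _ perfect w-straight =
    pos-≤-sub-add (subst (sumS H 3 + crossedG * m ^ (N ∸ 3) ≤_) (+-comm (countP M 3 (N ∸ 3) * m ^ (N ∸ 3)) (triangles M * m ^ (N ∸ 2))) sumS3+crossed≤)
  , pos-sub-≤ (doubled 4)
  , pos-≤-add-sub-mul {sumS H 5} {countP M 5 (N ∸ 3) * m ^ (N ∸ 3)} {countP M 5 (N ∸ 3)} sumS5≤ (count-rank3+not 5)
  , pos-sub-≤ (doubled 6)
  , sumS≤-large
  where
  open Bounds G H perfect w-straight k≥3
  doubled : ∀ i → countP M i (N ∸ 3) * m ^ (N ∸ 3) ≤ sumS H i + 2 * countP M i (N ∸ 3) * crossedG * m ^ (N ∸ 4)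
  doubled i = ≤-trans (sumS≥-rank3 i)
    (+-monoʳ-≤ (sumS H i) (*-monoˡ-≤ (m ^ (N ∸ 4)) (*-monoˡ-≤ crossedG (m≤n*m (countP M i (N ∸ 3)) 2))))
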